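{- Let $\boldsymbol w$ be a consistent type array and let $a,b,a^O,b^O,a^B,b^A$ be as defined below. (General enumeration) The number of two-type labeled plane forests with type array $\boldsymbol w$ equals $(a^Ob^O+a^Ob^A+a^Bb^O)(a-1)!(b-1)!$ if $a>0,b>0$; $a^O(a-1)!$ if $a>0,b=0$; $b^O(b-1)!$ if $a=0,b>0$; and $1$ if $a=b=0$. (Constrained enumeration) Assume $a>1$ and $w^{(1)}_0=A$. Then the number of two-type labeled plane forests with type array $\boldsymbol w$ in which vertex $1$ lies in the first tree equals $(b^O+b^A)(a-1)!(b-1)!$ if $b>0$ and $w^{(0)}_1=A$; $a^B(a-1)!(b-1)!$ if $b>0$ and $w^{(0)}_1=B$; and $(a-1)!$ if $b=0$.
   Context: A plane forest is a sequence of rooted plane trees; it is labeled if its vertices carry distinct labels, here $\{1,\ldots,n\}$; two-type means each vertex has a type $A$ or $B$. For vertex $i$ with $k_i$ children, $w^{(i)}=(w^{(i)}_0,\ldots,w^{(i)}_{k_i})\in\{A,B\}^{k_i+1}$ where $w^{(i)}_0$ is the type of $i$ and $w^{(i)}_j$ is the type of its $j$-th child in planar order. Also $w^{(0)}=(O,w^{(0)}_1,\ldots,w^{(0)}_{k_0})$ where $k_0$ is the number of trees and $w^{(0)}_j$ is the type of the root of the $j$-th tree. The type array is $\boldsymbol w=(w^{(0)},\ldots,w^{(n)})$. An array $(w^{(i)}_j)$ with $w^{(0)}_0=O$ and other entries in $\{A,B\}$ is consistent if $a:=\sum_{i=1}^n[w^{(i)}_0=A]=\sum_{i=0}^n\sum_{j=1}^{k_i}[w^{(i)}_j=A]$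 and $b:=\sum_{i=1}^n[w^{(i)}_0=B]=\sum_{i=0}^n\sum_{j=1}^{k_i}[w^{(i)}_j=B]$ ($[\cdot]$ the Iverson bracket). Set $a^O=\sum_{j=1}^{k_0}[w^{(0)}_j=A]$, $b^O=\sum_{j=1}^{k_0}[w^{(0)}_j=B]$, $a^B=\sum_{i=1}^n\sum_{j=1}^{k_i}[w^{(i)}_0=B][w^{(i)}_j=A]$, $b^A=\sum_{i=1}^n\sum_{j=1}^{k_i}[w^{(i)}_0=A][w^{(i)}_j=B]$. -}

module Defs where

open import Data.Bool using (Bool; true; false; _∧_; if_then_else_)
open import Data.Nat using (ℕ; zero; suc; _+_; _≡ᵇ_)
open import Data.Fin using (Fin; zero; suc)
open import Data.Fin.Properties using (_≟_)
open import Data.List using (List; []; _∷_; _++_; map; concat; concatMap; take; allFin)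
open import Data.Bool.ListAction using (all; any)
open import Data.Vec using (Vec; lookup; toList)
open import Data.Product using (_×_; _,_; proj₁; proj₂; Σ)
open import Relation.Nullary.Decidable using (⌊_⌋)
open import Data.Bool using (T)
open import Relation.Binary.PropositionalEquality using (_≡_)

data Ty : Set where
  A B : Ty

_==ᵗ_ : Ty → Ty → Bool
A ==ᵗ A = true
B ==ᵗ B = true
_ ==ᵗ _ = false

_==ˡ_ : List Ty → List Ty → Bool
[]       ==ˡ []       = true
(x ∷ xs) ==ˡ (y ∷ ys) = (x ==ᵗ y) ∧ (xs ==ˡ ys)
_        ==ˡ _        = false

-- Vertex labels {1,…,n} are represented by Fin n : label i+1 ↔ index i
-- (so vertex 1 is `zero`).
-- A type array w = (w^(0),…,w^(n)) is given by
--   w0 : List Ty                       -- (w^(0)_1,…,w^(0)_{k_0})  (types of the roots)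
--   w  : Fin n → Ty × List Ty          -- w v = (w^(v)_0 , (w^(v)_1,…,w^(v)_{k_v}))
-- (the leading entry w^(0)_0 = O is implicit).

typeOf : ∀ {n} → (Fin n → Ty × List Ty) → Fin n → Ty
typeOf w v = proj₁ (w v)

childTypes : ∀ {n} → (Fin n → Ty × List Ty) → Fin n → List Ty
childTypes w v = proj₂ (w v)

countTy : Ty → List Ty → ℕ
countTy t []       = 0
countTy t (x ∷ xs) = (if t ==ᵗ x then 1 else 0) + countTy t xs

nVert : ∀ {n} → Ty → (Fin n → Ty × List Ty) → ℕ
nVert t w = countTy t (map (typeOf w) (allFin _))

nSlots : ∀ {n} → Ty → List Ty → (Fin n → Ty × List Ty) → ℕ
nSlots t w0 w = countTy t w0 + countTy t (concat (map (childTypes w) (allFin _)))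

nSlotsUnder : ∀ {n} → Ty → Ty → (Fin n → Ty × List Ty) → ℕ
nSlotsUnder s t w =
  countTy t (concat (map (λ v → if s ==ᵗ typeOf w v then childTypes w v else []) (allFin _)))

a-of b-of : ∀ {n} → (Fin n → Ty × List Ty) → ℕ
a-of w = nVert A w
b-of w = nVert B w

aᴼ bᴼ : List Ty → ℕ
aᴼ w0 = countTy A w0
bᴼ w0 = countTy B w0

aᴮ bᴬ : ∀ {n} → (Fin n → Ty × List Ty) → ℕ
aᴮ w = nSlotsUnder B A w
bᴬ w = nSlotsUnder A B w

record Consistent {n : ℕ} (w0 : List Ty) (w : Fin n → Ty × List Ty) : Set where
  field
    consA : a-of w ≡ nSlots A w0 w
    consB : b-of w ≡ nSlots B w0 w

-- Labeled plane forests on {1,…,n}.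
-- A candidate is the ordered list of roots together with, for every
-- vertex, the ordered list of its children.

record PlaneForestData (n : ℕ) : Set where
  constructor mkPF
  field
    roots : List (Fin n)
    kids  : Vec (List (Fin n)) n
open PlaneForestData public

occ : ∀ {n} → Fin n → List (Fin n) → ℕ
occ v []       = 0
occ v (x ∷ xs) = (if ⌊ v ≟ x ⌋ then 1 else 0) + occ v xs

_∈ᵇ_ : ∀ {n} → Fin n → List (Fin n) → Bool
v ∈ᵇ xs = any (λ x → ⌊ v ≟ x ⌋) xs

desc : ∀ {n} → Vec (List (Fin n)) n → ℕ → List (Fin n) → List (Fin n)
desc ks zero    xs = xs
desc ks (suc m) xs = xs ++ desc ks m (concatMap (lookup ks) xs)

-- F is a plane forest on vertex set {1,…,n}: every vertex is the child of
-- exactly one node (the virtual root 0 or a vertex) and every vertex is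
-- reachable from the roots (no cycles).
isForest : ∀ {n} → PlaneForestData n → Bool
isForest {n} F =
  all (λ v → occ v (roots F ++ concat (toList (kids F))) ≡ᵇ 1) (allFin n)
  ∧ all (λ v → v ∈ᵇ desc (kids F) n (roots F)) (allFin n)

hasTypeArray : ∀ {n} → List Ty → (Fin n → Ty × List Ty) → PlaneForestData n → Bool
hasTypeArray {n} w0 w F =
  (map (typeOf w) (roots F) ==ˡ w0)
  ∧ all (λ v → map (typeOf w) (lookup (kids F) v) ==ˡ childTypes w v) (allFin n)

Forests : ∀ {n} → List Ty → (Fin n → Ty × List Ty) → Set
Forests w0 w = Σ (PlaneForestData _) (λ F → T (isForest F ∧ hasTypeArray w0 w F))

inFirstTree : ∀ {n} → Fin n → PlaneForestData n → Bool
inFirstTree {n} v F = v ∈ᵇ desc (kids F) n (take 1 (roots F))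

ForestsFirst : ∀ {n} → List Ty → (Fin (suc n) → Ty × List Ty) → Set
ForestsFirst w0 w =
  Σ (PlaneForestData _) (λ F → T (isForest F ∧ hasTypeArray w0 w F ∧ inFirstTree zero F))

-- Induction on the number of vertices, through an explicit bijection.  A vertex v
-- whose entry in the type array lists no children is a leaf in every forest of
-- that type array.  Deleting it leaves a forest on the other vertices whose type
-- array misses exactly the slot v occupied (a root position, or a child position
-- under some vertex, of v's type), and every such forest arises once from each
-- slot.  So the number of forests is the sum, over the slots of v's type, of the
-- numbers for the smaller type arrays, and the closed formulas satisfy the same
-- recurrence.  For forests with vertex 1 in the first tree (and v not vertex 1)
-- the first root slot is excluded: a leaf there would be the whole first tree.
-- Without a childless vertex, consistency leaves no room for roots, so there is
-- no forest on a nonempty vertex set; when only vertex 1 may be childless there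
-- is a single root, and then the constrained count is the general one.

module Submission where

open import Defs
open import Data.Nat.Properties hiding (_≟_)
open import Data.Nat.Properties using () renaming (_≟_ to _≟ℕ_)
open import Algebra.Properties.CommutativeMonoid.Sum +-0-commutativeMonoid using (sum; sum-syntax; sum-cong-≗; sum-remove; ∑-distrib-+)
open import Algebra.Properties.CommutativeSemigroup +-commutativeSemigroup using (x∙yz≈y∙xz; interchange)
open import Algebra.Properties.Semiring.Sum +-*-semiring using (*-distribʳ-sum)
open import Data.Bool using (Bool; true; false; if_then_else_; _∧_; T)
open import Data.Bool.ListAction using (all; any)
open import Data.Bool.Properties using (T-∧; T-irrelevant)
open import Data.Empty using (⊥; ⊥-elim)
open import Data.Fin using (Fin; zero; suc; toℕ; punchIn; punchOut)
open import Data.Fin.Properties using (_≟_; any?; punchInᵢ≢i; punchIn-punchOut; punchOut-punchIn; punchOut-cong; punchIn-injective; +↔⊎; *↔×)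
open import Data.List using (List; []; _∷_; _++_; map; concat; concatMap; tabulate; allFin; length; take; head)
open import Data.List.Membership.Propositional using (_∈_; find; lose)
open import Data.List.Membership.Propositional.Properties using (∈-++⁺ˡ; ∈-++⁺ʳ; ∈-++⁻; ∈-concatMap⁺; ∈-concatMap⁻; ∈-map⁺)
open import Data.List.Properties using (map-tabulate; ∷-injectiveˡ; ∷-injectiveʳ; map-∘; length-map)
open import Data.List.Relation.Unary.All.Properties using (all⁺; all⁻; tabulate⁺; tabulate⁻)
open import Data.List.Relation.Unary.Any as Any using (here; there; _─_)
open import Data.List.Relation.Unary.Any.Properties using (any⁺; any⁻; ¬Any[])
open import Data.Maybe using (Maybe; just; nothing)
open import Data.Nat using (ℕ; zero; suc; _+_; _*_; _∸_; _≤_; _<_; z≤n; s≤s; _≡ᵇ_; _!)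
open import Data.Nat.Tactic.RingSolver using (solve-∀)
open import Data.Product using (Σ; ∃; _×_; _,_; proj₁; proj₂)
open import Data.Product.Function.Dependent.Propositional using (Σ-↔)
open import Data.Product.Function.NonDependent.Propositional using (_×-↔_)
open import Data.Product.Properties using (Σ-≡,≡→≡)
open import Data.Sum using (_⊎_; inj₁; inj₂)
open import Data.Sum.Function.Propositional using (_⊎-↔_)
open import Data.Sum.Properties using (inj₂-injective)
open import Data.Unit using (⊤; tt)
open import Data.Vec as Vec using (Vec; lookup; toList)
open import Data.Vec.Properties using (lookup∘tabulate; tabulate∘lookup; tabulate-cong)
open import Function using (_∘_; id; Equivalence)
open import Function.Bundles using (_↔_; mk↔ₛ′)
open import Function.Properties.Inverse using (↔-trans; ↔-sym; ↔-refl)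
open import Function.Related.TypeIsomorphisms using (Σ-assoc; Σ-distribʳ-⊎)
open import Relation.Binary.PropositionalEquality
open import Relation.Nullary using (Dec; yes; no; ¬_; _×-dec_; ¬?)
open import Relation.Nullary.Decidable using (⌊_⌋; toWitness; fromWitness)

sum-zero : ∀ {n} (f : Fin n → ℕ) → (∀ i → f i ≡ 0) → sum f ≡ 0
sum-zero {zero}  f f≡0 = refl
sum-zero {suc n} f f≡0 = cong₂ _+_ (f≡0 zero) (sum-zero (f ∘ suc) (f≡0 ∘ suc))

sum-const-1 : ∀ n → ∑[ i < n ] 1 ≡ n
sum-const-1 zero    = refl
sum-const-1 (suc n) = cong suc (sum-const-1 n)

sum-mono-≤ : ∀ {n} {f g : Fin n → ℕ} → (∀ i → f i ≤ g i) → sum f ≤ sum g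
sum-mono-≤ {zero}  f≤g = z≤n
sum-mono-≤ {suc n} f≤g = +-mono-≤ (f≤g zero) (sum-mono-≤ (f≤g ∘ suc))

sum-mono-< : ∀ {n} {f g : Fin n → ℕ} → (∀ i → f i ≤ g i) → ∀ j → f j < g j → sum f < sum g
sum-mono-< f≤g zero    fj<gj = +-mono-<-≤ fj<gj (sum-mono-≤ (f≤g ∘ suc))
sum-mono-< f≤g (suc j) fj<gj = +-mono-≤-< (f≤g zero) (sum-mono-< (f≤g ∘ suc) j fj<gj)

≤-sum : ∀ {n} (f : Fin n → ℕ) i → f i ≤ sum f
≤-sum f zero    = m≤m+n (f zero) _
≤-sum f (suc i) = ≤-trans (≤-sum (f ∘ suc) i) (m≤n+m _ (f zero))

two≤-sum : ∀ {n} (f : Fin (suc n) → ℕ) {u u′} → u ≢ u′ → f u + f u′ ≤ sum f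
two≤-sum f {u} {u′} u≢u′ = begin
  f u + f u′                       ≡⟨ cong (λ x → f u + f x) (punchIn-punchOut u≢u′) ⟨
  f u + f (punchIn u (punchOut u≢u′)) ≤⟨ +-monoʳ-≤ (f u) (≤-sum (f ∘ punchIn u) (punchOut u≢u′)) ⟩
  f u + sum (f ∘ punchIn u)        ≡⟨ sum-remove f ⟨
  sum f                            ∎
  where open ≤-Reasoning

sum-concentrated : ∀ {n} (f : Fin n → ℕ) u → (∀ y → u ≢ y → f y ≡ 0) → sum f ≡ f u
sum-concentrated {suc n} f u f≡0 = begin
  sum f                       ≡⟨ sum-remove f ⟩
  f u + sum (f ∘ punchIn u)   ≡⟨ cong (f u +_) (sum-zero _ (λ y → f≡0 _ (punchInᵢ≢i u y ∘ sym))) ⟩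
  f u + 0                     ≡⟨ +-identityʳ (f u) ⟩
  f u                         ∎
  where open ≡-Reasoning

sum-differ-at : ∀ {n} {f g : Fin n → ℕ} u {d} → f u ≡ d + g u →
                (∀ y → u ≢ y → f y ≡ g y) → sum f ≡ d + sum g
sum-differ-at {suc n} {f} {g} u {d} fu≡d+gu f≡g = begin
  sum f                                  ≡⟨ sum-remove f ⟩
  f u + sum (f ∘ punchIn u)              ≡⟨ cong₂ _+_ fu≡d+gu (sum-cong-≗ (λ y → f≡g _ (punchInᵢ≢i u y ∘ sym))) ⟩
  d + g u + sum (g ∘ punchIn u)          ≡⟨ +-assoc d (g u) _ ⟩
  d + (g u + sum (g ∘ punchIn u))        ≡⟨ cong (d +_) (sum-remove g) ⟨
  d + sum g                              ∎
  where open ≡-Reasoning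

[_≡ᵗ_] : Ty → Ty → ℕ
[ t ≡ᵗ x ] = if t ==ᵗ x then 1 else 0

[A≡ᵗ]+[B≡ᵗ] : ∀ x → [ A ≡ᵗ x ] + [ B ≡ᵗ x ] ≡ 1
[A≡ᵗ]+[B≡ᵗ] A = refl
[A≡ᵗ]+[B≡ᵗ] B = refl

countTy-++ : ∀ t (xs ys : List Ty) → countTy t (xs ++ ys) ≡ countTy t xs + countTy t ys
countTy-++ t []       ys = refl
countTy-++ t (x ∷ xs) ys = trans (cong ([ t ≡ᵗ x ] +_) (countTy-++ t xs ys)) (sym (+-assoc [ t ≡ᵗ x ] _ _))

countTy-tabulate : ∀ {n} t (f : Fin n → Ty) → countTy t (tabulate f) ≡ ∑[ i < n ] [ t ≡ᵗ f i ]
countTy-tabulate {zero}  t f = refl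
countTy-tabulate {suc n} t f = cong ([ t ≡ᵗ f zero ] +_) (countTy-tabulate t (f ∘ suc))

countTy-concat-tabulate : ∀ {n} t (f : Fin n → List Ty) →
                          countTy t (concat (tabulate f)) ≡ ∑[ i < n ] countTy t (f i)
countTy-concat-tabulate {zero}  t f = refl
countTy-concat-tabulate {suc n} t f =
  trans (countTy-++ t (f zero) _) (cong (countTy t (f zero) +_) (countTy-concat-tabulate t (f ∘ suc)))

countTy-A+B : ∀ xs → countTy A xs + countTy B xs ≡ length xs
countTy-A+B []       = refl
countTy-A+B (A ∷ xs) = cong suc (countTy-A+B xs)
countTy-A+B (B ∷ xs) = trans (+-suc (countTy A xs) _) (cong suc (countTy-A+B xs))

childTypesUnder : ∀ {n} → Ty → (Fin n → Ty × List Ty) → Fin n → List Ty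
childTypesUnder s w v = if s ==ᵗ typeOf w v then childTypes w v else []

childTypes-split : ∀ {n} t (w : Fin n → Ty × List Ty) i →
                   countTy t (childTypes w i) ≡ countTy t (childTypesUnder A w i) + countTy t (childTypesUnder B w i)
childTypes-split t w i with typeOf w i
... | A = sym (+-identityʳ _)
... | B = refl

module _ {n : ℕ} (w : Fin n → Ty × List Ty) where

  nVert≡∑ : ∀ t → nVert t w ≡ ∑[ i < n ] [ t ≡ᵗ typeOf w i ]
  nVert≡∑ t = trans (cong (countTy t) (map-tabulate id (typeOf w))) (countTy-tabulate t (typeOf w))

  nVert-A+B : nVert A w + nVert B w ≡ n
  nVert-A+B = begin
    nVert A w + nVert B w                                      ≡⟨ cong₂ _+_ (nVert≡∑ A) (nVert≡∑ B) ⟩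
    sum (λ i → [ A ≡ᵗ typeOf w i ]) + sum (λ i → [ B ≡ᵗ typeOf w i ])
                                                               ≡⟨ ∑-distrib-+ (λ i → [ A ≡ᵗ typeOf w i ]) (λ i → [ B ≡ᵗ typeOf w i ]) ⟨
    ∑[ i < n ] ([ A ≡ᵗ typeOf w i ] + [ B ≡ᵗ typeOf w i ])       ≡⟨ sum-cong-≗ ([A≡ᵗ]+[B≡ᵗ] ∘ typeOf w) ⟩
    ∑[ i < n ] 1                                               ≡⟨ sum-const-1 n ⟩
    n                                                          ∎
    where open ≡-Reasoning

  childSlots≡∑ : ∀ t → countTy t (concat (map (childTypes w) (allFin n))) ≡ ∑[ i < n ] countTy t (childTypes w i)
  childSlots≡∑ t = trans (cong (countTy t ∘ concat) (map-tabulate id (childTypes w)))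
                         (countTy-concat-tabulate t (childTypes w))

  nSlotsUnder≡∑ : ∀ s t → nSlotsUnder s t w ≡ ∑[ i < n ] countTy t (childTypesUnder s w i)
  nSlotsUnder≡∑ s t = trans (cong (countTy t ∘ concat) (map-tabulate id (childTypesUnder s w)))
                            (countTy-concat-tabulate t (childTypesUnder s w))

module Reachability {n : ℕ} (ks : Vec (List (Fin n)) n) where

  children : Fin n → List (Fin n)
  children = lookup ks

  data Reachable (xs : List (Fin n)) : Fin n → Set where
    root : ∀ {x} → x ∈ xs → Reachable xs x
    step : ∀ {x y} → Reachable xs y → x ∈ children y → Reachable xs x

  Desc : ℕ → List (Fin n) → Fin n → Set
  Desc d xs x = x ∈ desc ks d xs

  Desc? : ∀ d xs x → Dec (Desc d xs x)
  Desc? d xs x = Any.any? (x ≟_) (desc ks d xs)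

  ∈children⁺ : ∀ {xs x y} → y ∈ xs → x ∈ children y → x ∈ concatMap children xs
  ∈children⁺ y∈xs x∈ky = ∈-concatMap⁺ children (lose y∈xs x∈ky)

  ∈children⁻ : ∀ {x} xs → x ∈ concatMap children xs → ∃ λ y → y ∈ xs × x ∈ children y
  ∈children⁻ xs x∈ = find (∈-concatMap⁻ children x∈)

  Desc-root : ∀ d {xs x} → x ∈ xs → Desc d xs x
  Desc-root zero    x∈xs = x∈xs
  Desc-root (suc d) x∈xs = ∈-++⁺ˡ x∈xs

  Desc-suc : ∀ d {xs x} → Desc d xs x → Desc (suc d) xs x
  Desc-suc zero    x∈ = ∈-++⁺ˡ x∈
  Desc-suc (suc d) {xs} x∈ with ∈-++⁻ xs x∈
  ... | inj₁ x∈xs = ∈-++⁺ˡ x∈xs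
  ... | inj₂ x∈ds = ∈-++⁺ʳ xs (Desc-suc d x∈ds)

  Desc-child : ∀ d {xs x y} → Desc d xs y → x ∈ children y → Desc (suc d) xs x
  Desc-child zero    {xs} y∈ x∈ky = ∈-++⁺ʳ xs (∈children⁺ y∈ x∈ky)
  Desc-child (suc d) {xs} y∈ x∈ky with ∈-++⁻ xs y∈
  ... | inj₁ y∈xs = ∈-++⁺ʳ xs (Desc-root (suc d) (∈children⁺ y∈xs x∈ky))
  ... | inj₂ y∈ds = ∈-++⁺ʳ xs (Desc-child d y∈ds x∈ky)

  Desc-parent : ∀ d xs {x} → Desc d (concatMap children xs) x → ∃ λ y → Desc d xs y × x ∈ children y
  Desc-parent zero    xs x∈ = ∈children⁻ xs x∈
  Desc-parent (suc d) xs x∈ with ∈-++⁻ (concatMap children xs) x∈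
  ... | inj₁ x∈cs = let y , y∈xs , x∈ky = ∈children⁻ xs x∈cs in y , ∈-++⁺ˡ y∈xs , x∈ky
  ... | inj₂ x∈ds = let y , y∈ , x∈ky = Desc-parent d (concatMap children xs) x∈ds in y , ∈-++⁺ʳ xs y∈ , x∈ky

  Desc-suc⁻ : ∀ d xs {x} → Desc (suc d) xs x → x ∈ xs ⊎ ∃ λ y → Desc d xs y × x ∈ children y
  Desc-suc⁻ d xs x∈ with ∈-++⁻ xs x∈
  ... | inj₁ x∈xs = inj₁ x∈xs
  ... | inj₂ x∈ds = inj₂ (Desc-parent d xs x∈ds)

  Desc⇒Reachable : ∀ d xs {x} → Desc d xs x → Reachable xs x
  Desc⇒Reachable zero    xs x∈ = root x∈
  Desc⇒Reachable (suc d) xs x∈ with Desc-suc⁻ d xs x∈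
  ... | inj₁ x∈xs           = root x∈xs
  ... | inj₂ (y , y∈ , x∈ky) = step (Desc⇒Reachable d xs y∈) x∈ky

  Reachable⇒Desc-some : ∀ {xs x} → Reachable xs x → ∃ λ d → Desc d xs x
  Reachable⇒Desc-some (root x∈xs) = 0 , x∈xs
  Reachable⇒Desc-some (step r x∈ky) = let d , y∈ = Reachable⇒Desc-some r in suc d , Desc-child d y∈ x∈ky

  -- Until the layers Desc d stop growing, each step adds a vertex; there are only n of them.
  module DepthBound (xs : List (Fin n)) where

    𝟙 : ℕ → Fin n → ℕ
    𝟙 d u with Desc? d xs u
    ... | yes _ = 1
    ... | no _  = 0

    𝟙≤1 : ∀ d u → 𝟙 d u ≤ 1
    𝟙≤1 d u with Desc? d xs u
    ... | yes _ = s≤s z≤n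
    ... | no _  = z≤n

    𝟙-mono : ∀ d u → 𝟙 d u ≤ 𝟙 (suc d) u
    𝟙-mono d u with Desc? d xs u | Desc? (suc d) xs u
    ... | yes _  | yes _  = s≤s z≤n
    ... | yes u∈ | no u∉ = ⊥-elim (u∉ (Desc-suc d u∈))
    ... | no _   | _      = z≤n

    𝟙-new : ∀ d u → Desc (suc d) xs u → ¬ Desc d xs u → 𝟙 d u < 𝟙 (suc d) u
    𝟙-new d u u∈ u∉ with Desc? d xs u | Desc? (suc d) xs u
    ... | yes u∈′ | _      = ⊥-elim (u∉ u∈′)
    ... | no _    | yes _  = s≤s z≤n
    ... | no _    | no u∉′ = ⊥-elim (u∉′ u∈)

    size : ℕ → ℕ
    size d = sum (𝟙 d)

    Stable : ℕ → Set
    Stable d = ∀ e u → Desc (d + e) xs u → Desc d xs u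

    stable-if-no-new : ∀ d → (∀ u → Desc (suc d) xs u → Desc d xs u) → Stable d
    stable-if-no-new d closed zero    u u∈ rewrite +-identityʳ d = u∈
    stable-if-no-new d closed (suc e) u u∈ rewrite +-suc d e with Desc-suc⁻ (d + e) xs u∈
    ... | inj₁ u∈xs            = Desc-root d u∈xs
    ... | inj₂ (y , y∈ , u∈ky) = closed u (Desc-child d (stable-if-no-new d closed e y y∈) u∈ky)

    stable-suc : ∀ d → Stable d → Stable (suc d)
    stable-suc d st e u u∈ = Desc-suc d (st (suc e) u (subst (λ k → Desc k xs u) (sym (+-suc d e)) u∈))

    stable-or-large : ∀ d → Stable d ⊎ d ≤ size d
    stable-or-large zero = inj₂ z≤n
    stable-or-large (suc d) with stable-or-large d
    ... | inj₁ st = inj₁ (stable-suc d st)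
    ... | inj₂ d≤size with any? (λ u → Desc? (suc d) xs u ×-dec ¬? (Desc? d xs u))
    ... | yes (u , u∈ , u∉) = inj₂ (≤-trans (s≤s d≤size) (sum-mono-< (𝟙-mono d) u (𝟙-new d u u∈ u∉)))
    ... | no none = inj₁ (stable-suc d (stable-if-no-new d closed))
      where
        closed : ∀ u → Desc (suc d) xs u → Desc d xs u
        closed u u∈ with Desc? d xs u
        ... | yes u∈′ = u∈′
        ... | no u∉   = ⊥-elim (none (u , u∈ , u∉))

    all-in-Desc-n : n ≤ size n → ∀ u → Desc n xs u
    all-in-Desc-n n≤size u with Desc? n xs u in eq
    ... | yes u∈ = u∈
    ... | no _   = ⊥-elim (<⇒≱ (sum-mono-< (𝟙≤1 n) u 𝟙u<1) (subst (_≤ size n) (sym (sum-const-1 n)) n≤size))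
      where
        𝟙u<1 : 𝟙 n u < 1
        𝟙u<1 rewrite eq = s≤s z≤n

    Desc-n : ∀ d u → Desc d xs u → Desc n xs u
    Desc-n d u u∈ with stable-or-large n
    ... | inj₂ n≤size = all-in-Desc-n n≤size u
    ... | inj₁ st with ≤-total d n
    ... | inj₁ d≤n = subst (λ k → Desc k xs u) (m∸n+n≡m d≤n) (raise (n ∸ d) u∈)
      where
        raise : ∀ k {d} → Desc d xs u → Desc (k + d) xs u
        raise zero    u∈ = u∈
        raise (suc k) {d} u∈ = Desc-suc (k + d) (raise k u∈)
    ... | inj₂ n≤d = st (d ∸ n) u (subst (λ k → Desc k xs u) (sym (m+[n∸m]≡n n≤d)) u∈)

  Reachable⇒Desc : ∀ {xs x} → Reachable xs x → Desc n xs x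
  Reachable⇒Desc {xs} {x} r = let d , x∈ = Reachable⇒Desc-some r in DepthBound.Desc-n xs d x x∈

open Reachability using (Reachable; root; step; Desc⇒Reachable; Reachable⇒Desc)

[_≡ᶠ_] : ∀ {n} → Fin n → Fin n → ℕ
[ x ≡ᶠ y ] = if ⌊ x ≟ y ⌋ then 1 else 0

[x≡ᶠx] : ∀ {n} (x : Fin n) → [ x ≡ᶠ x ] ≡ 1
[x≡ᶠx] x with x ≟ x
... | yes _  = refl
... | no x≢x = ⊥-elim (x≢x refl)

[x≡ᶠy] : ∀ {n} {x y : Fin n} → x ≢ y → [ x ≡ᶠ y ] ≡ 0
[x≡ᶠy] {x = x} {y} x≢y with x ≟ y
... | yes x≡y = ⊥-elim (x≢y x≡y)
... | no _    = refl

occ-++ : ∀ {n} (x : Fin n) xs ys → occ x (xs ++ ys) ≡ occ x xs + occ x ys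
occ-++ x []       ys = refl
occ-++ x (y ∷ xs) ys = trans (cong ([ x ≡ᶠ y ] +_) (occ-++ x xs ys)) (sym (+-assoc [ x ≡ᶠ y ] (occ x xs) _))

occ-concat : ∀ {n m} (x : Fin n) (ks : Vec (List (Fin n)) m) →
             occ x (concat (toList ks)) ≡ ∑[ i < m ] occ x (lookup ks i)
occ-concat x Vec.[]       = refl
occ-concat x (k Vec.∷ ks) = trans (occ-++ x k _) (cong (occ x k +_) (occ-concat x ks))

∈⇒occ≥1 : ∀ {n} {x : Fin n} {xs} → x ∈ xs → 1 ≤ occ x xs
∈⇒occ≥1 {x = x} (here refl) rewrite [x≡ᶠx] x = s≤s z≤n
∈⇒occ≥1 {x = x} {y ∷ xs} (there x∈xs) = ≤-trans (∈⇒occ≥1 x∈xs) (m≤n+m (occ x xs) [ x ≡ᶠ y ])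

∉⇒occ≡0 : ∀ {n} {x : Fin n} xs → ¬ x ∈ xs → occ x xs ≡ 0
∉⇒occ≡0 []       x∉ = refl
∉⇒occ≡0 (y ∷ xs) x∉ = cong₂ _+_ ([x≡ᶠy] (x∉ ∘ here)) (∉⇒occ≡0 xs (x∉ ∘ there))

nth : {X : Set} → ℕ → List X → Maybe X
nth k       []       = nothing
nth zero    (x ∷ xs) = just x
nth (suc k) (x ∷ xs) = nth k xs

nth⇒∈ : ∀ {X : Set} k (xs : List X) {x} → nth k xs ≡ just x → x ∈ xs
nth⇒∈ zero    (y ∷ xs) refl = here refl
nth⇒∈ (suc k) (y ∷ xs) eq   = there (nth⇒∈ k xs eq)

nth-idx : ∀ {X : Set} {x : X} {xs} (m : x ∈ xs) → nth (toℕ (Any.index m)) xs ≡ just x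
nth-idx (here refl) = refl
nth-idx (there m)   = nth-idx m

nth-twice⇒occ≥2 : ∀ {n} {x : Fin n} k k′ xs → nth k xs ≡ just x → nth k′ xs ≡ just x → k ≢ k′ → 2 ≤ occ x xs
nth-twice⇒occ≥2 zero     zero     (y ∷ xs) eq eq′ k≢k′ = ⊥-elim (k≢k′ refl)
nth-twice⇒occ≥2 {x = x} zero (suc k′) (y ∷ xs) refl eq′ _ rewrite [x≡ᶠx] x = s≤s (∈⇒occ≥1 (nth⇒∈ k′ xs eq′))
nth-twice⇒occ≥2 {x = x} (suc k) zero (y ∷ xs) eq refl _ rewrite [x≡ᶠx] x = s≤s (∈⇒occ≥1 (nth⇒∈ k xs eq))
nth-twice⇒occ≥2 {x = x} (suc k) (suc k′) (y ∷ xs) eq eq′ k≢k′ =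
  ≤-trans (nth-twice⇒occ≥2 k k′ xs eq eq′ (k≢k′ ∘ cong suc)) (m≤n+m (occ x xs) [ x ≡ᶠ y ])

record IsTypedForest {n} (w0 : List Ty) (w : Fin n → Ty × List Ty) (F : PlaneForestData n) : Set where
  field
    one-parent : ∀ x → occ x (roots F) + ∑[ i < n ] occ x (lookup (kids F) i) ≡ 1
    reachable  : ∀ x → Reachable (kids F) (roots F) x
    root-types : map (typeOf w) (roots F) ≡ w0
    kid-types  : ∀ x → map (typeOf w) (lookup (kids F) x) ≡ childTypes w x
open IsTypedForest public

==ˡ⇒≡ : ∀ {xs ys} → T (xs ==ˡ ys) → xs ≡ ys
==ˡ⇒≡ {[]}     {[]}     _ = refl
==ˡ⇒≡ {A ∷ xs} {A ∷ ys} t = cong (A ∷_) (==ˡ⇒≡ t)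
==ˡ⇒≡ {B ∷ xs} {B ∷ ys} t = cong (B ∷_) (==ˡ⇒≡ t)

≡⇒==ˡ : ∀ {xs ys} → xs ≡ ys → T (xs ==ˡ ys)
≡⇒==ˡ {[]}     refl = _
≡⇒==ˡ {A ∷ xs} refl = ≡⇒==ˡ {xs} refl
≡⇒==ˡ {B ∷ xs} refl = ≡⇒==ˡ {xs} refl

T-all-allFin⁻ : ∀ {n} (p : Fin n → Bool) → T (all p (allFin n)) → ∀ i → T (p i)
T-all-allFin⁻ p t = tabulate⁻ (all⁺ p _ t)

T-all-allFin⁺ : ∀ {n} (p : Fin n → Bool) → (∀ i → T (p i)) → T (all p (allFin n))
T-all-allFin⁺ p pᵢ = all⁻ p (tabulate⁺ pᵢ)

T-∈ᵇ⁻ : ∀ {n} (x : Fin n) xs → T (x ∈ᵇ xs) → x ∈ xs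
T-∈ᵇ⁻ x xs t = Any.map toWitness (any⁻ _ xs t)

T-∈ᵇ⁺ : ∀ {n} (x : Fin n) {xs} → x ∈ xs → T (x ∈ᵇ xs)
T-∈ᵇ⁺ x x∈xs = any⁺ _ (Any.map fromWitness x∈xs)

module _ {n} {w0 : List Ty} {w : Fin n → Ty × List Ty} {F : PlaneForestData n} where

  private
    occ-parents : ∀ x → occ x (roots F ++ concat (toList (kids F))) ≡ occ x (roots F) + ∑[ i < n ] occ x (lookup (kids F) i)
    occ-parents x = trans (occ-++ x (roots F) _) (cong (occ x (roots F) +_) (occ-concat x (kids F)))

  T⇒IsTypedForest : T (isForest F ∧ hasTypeArray w0 w F) → IsTypedForest w0 w F
  T⇒IsTypedForest t = record
    { one-parent = λ x → trans (sym (occ-parents x)) (≡ᵇ⇒≡ _ _ (T-all-allFin⁻ _ t-occ x))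
    ; reachable  = λ x → Desc⇒Reachable (kids F) n (roots F) (T-∈ᵇ⁻ x _ (T-all-allFin⁻ _ t-reach x))
    ; root-types = ==ˡ⇒≡ t-roots
    ; kid-types  = λ x → ==ˡ⇒≡ (T-all-allFin⁻ _ t-kids x)
    }
    where
      t-forest = proj₁ (Equivalence.to (T-∧ {isForest F}) t)
      t-types  = proj₂ (Equivalence.to (T-∧ {isForest F}) t)
      occ-ok   = all (λ v → occ v (roots F ++ concat (toList (kids F))) ≡ᵇ 1) (allFin n)
      t-occ    = proj₁ (Equivalence.to (T-∧ {occ-ok}) t-forest)
      t-reach  = proj₂ (Equivalence.to (T-∧ {occ-ok}) t-forest)
      t-roots  = proj₁ (Equivalence.to (T-∧ {map (typeOf w) (roots F) ==ˡ w0}) t-types)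
      t-kids   = proj₂ (Equivalence.to (T-∧ {map (typeOf w) (roots F) ==ˡ w0}) t-types)

  IsTypedForest⇒T : IsTypedForest w0 w F → T (isForest F ∧ hasTypeArray w0 w F)
  IsTypedForest⇒T tf = Equivalence.from T-∧
    ( Equivalence.from T-∧
        ( T-all-allFin⁺ _ (λ x → ≡⇒≡ᵇ _ _ (trans (occ-parents x) (one-parent tf x)))
        , T-all-allFin⁺ _ (λ x → T-∈ᵇ⁺ x (Reachable⇒Desc (kids F) (reachable tf x))))
    , Equivalence.from T-∧ (≡⇒==ˡ (root-types tf) , T-all-allFin⁺ _ (λ x → ≡⇒==ˡ (kid-types tf x))))

T-inFirstTree⁻ : ∀ {n} (F : PlaneForestData (suc n)) → T (inFirstTree zero F) → Reachable (kids F) (take 1 (roots F)) zero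
T-inFirstTree⁻ {n} F t = Desc⇒Reachable (kids F) (suc n) _ (T-∈ᵇ⁻ zero _ t)

T-inFirstTree⁺ : ∀ {n} (F : PlaneForestData (suc n)) → Reachable (kids F) (take 1 (roots F)) zero → T (inFirstTree zero F)
T-inFirstTree⁺ F r = T-∈ᵇ⁺ zero (Reachable⇒Desc (kids F) r)

idx : ∀ {X : Set} {x : X} {xs} → x ∈ xs → ℕ
idx p = toℕ (Any.index p)

-- Past the end of the list, insertAt appends.
insertAt : ∀ {X Y : Set} {y : Y} {ys} → y ∈ ys → X → List X → List X
insertAt (here _)  x xs       = x ∷ xs
insertAt (there p) x []       = x ∷ []
insertAt (there p) x (z ∷ zs) = z ∷ insertAt p x zs

module _ {X Y : Set} {y : Y} where

  map-insertAt : ∀ {Z : Set} (f : X → Z) {ys} (p : y ∈ ys) (x : X) (xs : List X) → map f (insertAt p x xs) ≡ insertAt p (f x) (map f xs)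
  map-insertAt f (here _)  x xs       = refl
  map-insertAt f (there p) x []       = refl
  map-insertAt f (there p) x (z ∷ zs) = cong (f z ∷_) (map-insertAt f p x zs)

  insertAt-─ : ∀ {ys} (p : y ∈ ys) → insertAt p y (ys ─ p) ≡ ys
  insertAt-─ (here refl) = refl
  insertAt-─ (there p)   = cong (_ ∷_) (insertAt-─ p)

  map-insertAt⁺ : (f : X → Y) {ys : List Y} (p : y ∈ ys) → ∀ {x xs} → map f xs ≡ (ys ─ p) → f x ≡ y →
                  map f (insertAt p x xs) ≡ ys
  map-insertAt⁺ f {ys} p {x} {xs} fxs≡ fx≡y = begin
    map f (insertAt p x xs)        ≡⟨ map-insertAt f p x xs ⟩
    insertAt p (f x) (map f xs)    ≡⟨ cong₂ (insertAt p) fx≡y fxs≡ ⟩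
    insertAt p y (ys ─ p)          ≡⟨ insertAt-─ p ⟩
    ys                             ∎
    where open ≡-Reasoning

  map-insertAt⁻ : (f : X → Y) {ys : List Y} (p : y ∈ ys) → ∀ {x} xs → map f (insertAt p x xs) ≡ ys → map f xs ≡ (ys ─ p)
  map-insertAt⁻ f (here refl) xs       eq = ∷-injectiveʳ eq
  map-insertAt⁻ f (there p)   []       eq = ⊥-elim (¬Any[] (subst (_ ∈_) (sym (∷-injectiveʳ eq)) p))
  map-insertAt⁻ f (there p)   (z ∷ zs) eq = cong₂ _∷_ (∷-injectiveˡ eq) (map-insertAt⁻ f p zs (∷-injectiveʳ eq))

  nth-insertAt : (f : X → Y) {ys : List Y} (p : y ∈ ys) (x : X) (xs : List X) → map f xs ≡ (ys ─ p) → nth (idx p) (insertAt p x xs) ≡ just x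
  nth-insertAt f (here _)  x xs       _  = refl
  nth-insertAt f (there p) x (z ∷ zs) eq = nth-insertAt f p x zs (∷-injectiveʳ eq)

  ∈-insertAt⁺ : ∀ {ys} (p : y ∈ ys) {x z : X} (xs : List X) → z ∈ xs → z ∈ insertAt p x xs
  ∈-insertAt⁺ (here _)  xs       z∈     = there z∈
  ∈-insertAt⁺ (there p) (_ ∷ zs) (here eq) = here eq
  ∈-insertAt⁺ (there p) (_ ∷ zs) (there z∈) = there (∈-insertAt⁺ p zs z∈)

  ∈-insertAt-self : ∀ {ys} (p : y ∈ ys) (x : X) (xs : List X) → x ∈ insertAt p x xs
  ∈-insertAt-self (here _)  x xs       = here refl
  ∈-insertAt-self (there p) x []       = here refl
  ∈-insertAt-self (there p) x (z ∷ zs) = there (∈-insertAt-self p x zs)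

idx-map⁺ : ∀ {X Y : Set} (f : X → Y) {x : X} {xs : List X} (m : x ∈ xs) → Σ (f x ∈ map f xs) (λ p → idx p ≡ idx m)
idx-map⁺ f (here refl) = here refl , refl
idx-map⁺ f (there m)   = let p , idx≡ = idx-map⁺ f m in there p , cong suc idx≡

occ-insertAt : ∀ {Y : Set} {y : Y} {ys} {n} (p : y ∈ ys) (x z : Fin n) (xs : List (Fin n)) → occ x (insertAt p z xs) ≡ [ x ≡ᶠ z ] + occ x xs
occ-insertAt (here _)  x z xs       = refl
occ-insertAt (there p) x z []       = refl
occ-insertAt (there p) x z (u ∷ us) =
  trans (cong ([ x ≡ᶠ u ] +_) (occ-insertAt p x z us)) (x∙yz≈y∙xz [ x ≡ᶠ u ] [ x ≡ᶠ z ] (occ x us))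

idx-injective : ∀ {X : Set} {x : X} {xs} (p q : x ∈ xs) → idx p ≡ idx q → p ≡ q
idx-injective (here refl) (here refl) _  = refl
idx-injective (there p)   (there q)   eq = cong there (idx-injective p q (suc-injective eq))

idx-subst : ∀ {X : Set} {x : X} {xs ys} (eq : xs ≡ ys) (p : x ∈ xs) → idx (subst (x ∈_) eq p) ≡ idx p
idx-subst refl p = refl

countTy-─ : ∀ c {t} {ts : List Ty} (p : t ∈ ts) → countTy c ts ≡ [ c ≡ᵗ t ] + countTy c (ts ─ p)
countTy-─ c (here refl) = refl
countTy-─ c {t} (there {x = x} {xs = ts} p) =
  trans (cong ([ c ≡ᵗ x ] +_) (countTy-─ c p)) (x∙yz≈y∙xz [ c ≡ᵗ x ] [ c ≡ᵗ t ] (countTy c (ts ─ p)))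

private
  ∈-cons↔ : ∀ {t : Ty} {ts k} → (t ∈ ts) ↔ Fin k → (t ∈ t ∷ ts) ↔ Fin (suc k)
  ∈-cons↔ {k = k} ts↔k = ↔-trans split (↔-trans (↔-refl ⊎-↔ ts↔k) (↔-sym (+↔⊎ {1} {k})))
    where
      split = mk↔ₛ′ (λ { (here refl) → inj₁ zero ; (there p) → inj₂ p })
                    (λ { (inj₁ zero) → here refl ; (inj₂ p) → there p })
                    (λ { (inj₁ zero) → refl ; (inj₂ _) → refl })
                    (λ { (here refl) → refl ; (there _) → refl })

  ∈-skip↔ : ∀ {t x : Ty} {ts} → t ≢ x → (t ∈ x ∷ ts) ↔ (t ∈ ts)
  ∈-skip↔ t≢x = mk↔ₛ′ (λ { (here t≡x) → ⊥-elim (t≢x t≡x) ; (there p) → p }) there (λ _ → refl)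
                      (λ { (here t≡x) → ⊥-elim (t≢x t≡x) ; (there p) → refl })

positions↔ : ∀ t ts → (t ∈ ts) ↔ Fin (countTy t ts)
positions↔ t []       = mk↔ₛ′ (λ ()) (λ ()) (λ ()) (λ ())
positions↔ A (A ∷ ts) = ∈-cons↔ (positions↔ A ts)
positions↔ B (B ∷ ts) = ∈-cons↔ (positions↔ B ts)
positions↔ A (B ∷ ts) = ↔-trans (∈-skip↔ (λ ())) (positions↔ A ts)
positions↔ B (A ∷ ts) = ↔-trans (∈-skip↔ (λ ())) (positions↔ B ts)

-- Removing a leaf

module Strip {n : ℕ} (v : Fin (suc n)) where

  ι : Fin n → Fin (suc n)
  ι = punchIn v

  v≢ι : ∀ y → v ≢ ι y
  v≢ι y = punchInᵢ≢i v y ∘ sym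

  punchOut-ι : ∀ y (v≢ιy : v ≢ ι y) → punchOut v≢ιy ≡ y
  punchOut-ι y _ = trans (punchOut-cong v refl) (punchOut-punchIn v)

  strip : List (Fin (suc n)) → List (Fin n)
  strip [] = []
  strip (x ∷ xs) with v ≟ x
  ... | yes _   = strip xs
  ... | no v≢x = punchOut v≢x ∷ strip xs

  strip-map-ι : ∀ xs → strip (map ι xs) ≡ xs
  strip-map-ι [] = refl
  strip-map-ι (y ∷ ys) with v ≟ ι y
  ... | yes v≡ιy = ⊥-elim (v≢ι y v≡ιy)
  ... | no v≢ιy  = cong₂ _∷_ (punchOut-ι y v≢ιy) (strip-map-ι ys)

  strip-insertAt : ∀ {Y : Set} {y : Y} {ys} (p : y ∈ ys) xs → strip (insertAt p v xs) ≡ strip xs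
  strip-insertAt (here _) xs with v ≟ v
  ... | yes _  = refl
  ... | no v≢v = ⊥-elim (v≢v refl)
  strip-insertAt (there p) [] with v ≟ v
  ... | yes _  = refl
  ... | no v≢v = ⊥-elim (v≢v refl)
  strip-insertAt (there p) (x ∷ xs) with v ≟ x
  ... | yes _   = strip-insertAt p xs
  ... | no v≢x = cong (punchOut v≢x ∷_) (strip-insertAt p xs)

  occ-strip : ∀ y xs → occ y (strip xs) ≡ occ (ι y) xs
  occ-strip y [] = refl
  occ-strip y (x ∷ xs) with v ≟ x
  ... | yes refl = trans (occ-strip y xs) (cong (_+ occ (ι y) xs) (sym ([x≡ᶠy] (v≢ι y ∘ sym))))
  ... | no v≢x  = cong₂ _+_ (same y x v≢x) (occ-strip y xs)
    where
      same : ∀ y x (v≢x : v ≢ x) → [ y ≡ᶠ punchOut v≢x ] ≡ [ ι y ≡ᶠ x ]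
      same y x v≢x with y ≟ punchOut v≢x | ι y ≟ x
      ... | yes _   | yes _   = refl
      ... | no _    | no _    = refl
      ... | yes y≡  | no ιy≢x = ⊥-elim (ιy≢x (trans (cong ι y≡) (punchIn-punchOut v≢x)))
      ... | no y≢   | yes refl = ⊥-elim (y≢ (sym (punchOut-ι y v≢x)))

  occ-v-map-ι : ∀ ys → occ v (map ι ys) ≡ 0
  occ-v-map-ι []       = refl
  occ-v-map-ι (y ∷ ys) = cong₂ _+_ ([x≡ᶠy] (v≢ι y)) (occ-v-map-ι ys)

  occ-ι-map-ι : ∀ y ys → occ (ι y) (map ι ys) ≡ occ y ys
  occ-ι-map-ι y []       = refl
  occ-ι-map-ι y (z ∷ zs) = cong₂ _+_ same (occ-ι-map-ι y zs)
    where
      same : [ ι y ≡ᶠ ι z ] ≡ [ y ≡ᶠ z ]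
      same with ι y ≟ ι z | y ≟ z
      ... | yes _   | yes _   = refl
      ... | no _    | no _    = refl
      ... | yes ιy≡ | no y≢z  = ⊥-elim (y≢z (punchIn-injective v y z ιy≡))
      ... | no ιy≢  | yes y≡z = ⊥-elim (ιy≢ (cong ι y≡z))

  occ-ι-insertAt-v : ∀ {Y : Set} {y : Y} {ys} (p : y ∈ ys) x xs → occ (ι x) (insertAt p v (map ι xs)) ≡ occ x xs
  occ-ι-insertAt-v p x xs = trans (occ-insertAt p (ι x) v (map ι xs))
                                  (cong₂ _+_ ([x≡ᶠy] (v≢ι x ∘ sym)) (occ-ι-map-ι x xs))

  occ-v-insertAt-v : ∀ {Y : Set} {y : Y} {ys} (p : y ∈ ys) xs → occ v (insertAt p v (map ι xs)) ≡ 1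
  occ-v-insertAt-v p xs = trans (occ-insertAt p v v (map ι xs)) (cong₂ _+_ ([x≡ᶠx] v) (occ-v-map-ι xs))

  map-ι-strip : ∀ xs → occ v xs ≡ 0 → map ι (strip xs) ≡ xs
  map-ι-strip []       _   = refl
  map-ι-strip (x ∷ xs) occ≡0 with v ≟ x
  ... | yes _   = ⊥-elim (0≢1+n (sym occ≡0))
  ... | no v≢x = cong₂ _∷_ (punchIn-punchOut v≢x) (map-ι-strip xs occ≡0)

  insertAt-map-ι-strip : ∀ {t : Ty} {ts} (p : t ∈ ts) xs → nth (idx p) xs ≡ just v → occ v xs ≡ 1 →
                         insertAt p v (map ι (strip xs)) ≡ xs
  insertAt-map-ι-strip (here _) (x ∷ xs) refl occ≡1 with v ≟ v
  ... | yes _  = cong (v ∷_) (map-ι-strip xs (suc-injective occ≡1))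
  ... | no v≢v = ⊥-elim (v≢v refl)
  insertAt-map-ι-strip (there p) (x ∷ xs) nth≡ occ≡1 with v ≟ x
  ... | yes refl = ⊥-elim (<-irrefl refl (≤-trans (s≤s (∈⇒occ≥1 (nth⇒∈ _ xs nth≡))) (≤-reflexive occ≡1)))
  ... | no v≢x  = cong₂ _∷_ (punchIn-punchOut v≢x) (insertAt-map-ι-strip p xs nth≡ occ≡1)

  ∈-strip : ∀ {x} xs → x ∈ xs → (v≢x : v ≢ x) → punchOut v≢x ∈ strip xs
  ∈-strip (x ∷ xs) (here refl) v≢x with v ≟ x
  ... | yes v≡x  = ⊥-elim (v≢x v≡x)
  ... | no _     = here (punchOut-cong v refl)
  ∈-strip (y ∷ xs) (there x∈) v≢x with v ≟ y
  ... | yes _ = ∈-strip xs x∈ v≢x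
  ... | no _  = there (∈-strip xs x∈ v≢x)

map≡[]⇒≡[] : ∀ {X Y : Set} (f : X → Y) xs → map f xs ≡ [] → xs ≡ []
map≡[]⇒≡[] f [] _ = refl

module LeafRemoval {n : ℕ} (w0 : List Ty) (w : Fin (suc n) → Ty × List Ty)
                   (v : Fin (suc n)) (leaf : childTypes w v ≡ []) where

  open Strip v public

  ty : Fin (suc n) → Ty
  ty = typeOf w

  t : Ty
  t = ty v

  SlotIn : List Ty → Set
  SlotIn roots = t ∈ roots ⊎ Σ (Fin (suc n)) (λ u → t ∈ childTypes w u)

  Slot : Set
  Slot = SlotIn w0

  pattern rootSlot p  = inj₁ p
  pattern kidSlot u p = inj₂ (u , p)

  leaf-no-slot : ∀ {x} → ¬ x ∈ childTypes w v
  leaf-no-slot p = ¬Any[] (subst (_ ∈_) leaf p)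

  rootTypes′ : Slot → List Ty
  rootTypes′ (rootSlot p)  = w0 ─ p
  rootTypes′ (kidSlot _ _) = w0

  childTypes′ : Slot → Fin (suc n) → List Ty
  childTypes′ (rootSlot _)  x = childTypes w x
  childTypes′ (kidSlot u p) x with u ≟ x
  ... | yes refl = childTypes w u ─ p
  ... | no _     = childTypes w x

  w′ : Slot → Fin n → Ty × List Ty
  w′ s y = ty (ι y) , childTypes′ s (ι y)

  Typed : PlaneForestData (suc n) → Set
  Typed = IsTypedForest w0 w

  Typed′ : Slot → PlaneForestData n → Set
  Typed′ s = IsTypedForest (rootTypes′ s) (w′ s)

  insertKid : Slot → Fin (suc n) → List (Fin (suc n)) → List (Fin (suc n))
  insertKid (rootSlot _)  x xs = xs
  insertKid (kidSlot u p) x xs with u ≟ x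
  ... | yes refl = insertAt p v xs
  ... | no _     = xs

  kids⁺ : Slot → PlaneForestData n → Fin (suc n) → List (Fin (suc n))
  kids⁺ s F′ x with v ≟ x
  ... | yes _   = []
  ... | no v≢x = insertKid s x (map ι (lookup (kids F′) (punchOut v≢x)))

  roots⁺ : Slot → List (Fin n) → List (Fin (suc n))
  roots⁺ (rootSlot p)  r = insertAt p v (map ι r)
  roots⁺ (kidSlot _ _) r = map ι r

  insertLeaf : Slot → PlaneForestData n → PlaneForestData (suc n)
  insertLeaf s F′ = mkPF (roots⁺ s (roots F′)) (Vec.tabulate (kids⁺ s F′))

  removeLeaf : PlaneForestData (suc n) → PlaneForestData n
  removeLeaf F = mkPF (strip (roots F)) (Vec.tabulate (λ y → strip (lookup (kids F) (ι y))))

  LeafAt : Slot → PlaneForestData (suc n) → Set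
  LeafAt (rootSlot p)  F = nth (idx p) (roots F) ≡ just v
  LeafAt (kidSlot u p) F = nth (idx p) (lookup (kids F) u) ≡ just v

  data Vertex : Fin (suc n) → Set where
    the-leaf : Vertex v
    other    : ∀ y → Vertex (ι y)

  vertex : ∀ x → Vertex x
  vertex x with v ≟ x
  ... | yes refl = the-leaf
  ... | no v≢x  = subst Vertex (punchIn-punchOut v≢x) (other (punchOut v≢x))

  data SlotUnder (s : Slot) (x : Fin (suc n)) : Set where
    slot-here      : (p : t ∈ childTypes w x) → s ≡ kidSlot x p → SlotUnder s x
    slot-elsewhere : (∀ xs → insertKid s x xs ≡ xs) → childTypes′ s x ≡ childTypes w x →
                     (∀ p → s ≢ kidSlot x p) → SlotUnder s x

  insertKid-here : ∀ x (p : t ∈ childTypes w x) xs → insertKid (kidSlot x p) x xs ≡ insertAt p v xs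
  insertKid-here x p xs with x ≟ x
  ... | yes refl = refl
  ... | no x≢x   = ⊥-elim (x≢x refl)

  childTypes′-here : ∀ x (p : t ∈ childTypes w x) → childTypes′ (kidSlot x p) x ≡ (childTypes w x ─ p)
  childTypes′-here x p with x ≟ x
  ... | yes refl = refl
  ... | no x≢x   = ⊥-elim (x≢x refl)

  slotUnder : ∀ s x → SlotUnder s x
  slotUnder (rootSlot p)  x = slot-elsewhere (λ _ → refl) refl (λ _ ())
  slotUnder (kidSlot u p) x with u ≟ x
  ... | yes refl = slot-here p refl
  ... | no u≢x  = slot-elsewhere (λ xs → other-kids xs) other-types (λ { _ refl → u≢x refl })
    where
      other-kids : ∀ xs → insertKid (kidSlot u p) x xs ≡ xs
      other-kids xs with u ≟ x
      ... | yes u≡x = ⊥-elim (u≢x u≡x)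
      ... | no _    = refl
      other-types : childTypes′ (kidSlot u p) x ≡ childTypes w x
      other-types with u ≟ x
      ... | yes u≡x = ⊥-elim (u≢x u≡x)
      ... | no _    = refl

  kids⁺-v : ∀ s F′ → kids⁺ s F′ v ≡ []
  kids⁺-v s F′ with v ≟ v
  ... | yes _  = refl
  ... | no v≢v = ⊥-elim (v≢v refl)

  kids⁺-ι : ∀ s F′ y → kids⁺ s F′ (ι y) ≡ insertKid s (ι y) (map ι (lookup (kids F′) y))
  kids⁺-ι s F′ y with v ≟ ι y
  ... | yes v≡ιy = ⊥-elim (v≢ι y v≡ιy)
  ... | no v≢ιy  = cong (λ z → insertKid s (ι y) (map ι (lookup (kids F′) z))) (punchOut-ι y v≢ιy)

  lookup-insertLeaf : ∀ s F′ x → lookup (kids (insertLeaf s F′)) x ≡ kids⁺ s F′ x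
  lookup-insertLeaf s F′ = lookup∘tabulate (kids⁺ s F′)

  lookup-removeLeaf : ∀ F y → lookup (kids (removeLeaf F)) y ≡ strip (lookup (kids F) (ι y))
  lookup-removeLeaf F = lookup∘tabulate (λ y → strip (lookup (kids F) (ι y)))

  lookup-insertLeaf-ι : ∀ s F′ y → lookup (kids (insertLeaf s F′)) (ι y) ≡ insertKid s (ι y) (map ι (lookup (kids F′) y))
  lookup-insertLeaf-ι s F′ y = trans (lookup-insertLeaf s F′ (ι y)) (kids⁺-ι s F′ y)

  ι-root-types : ∀ s F′ → Typed′ s F′ → map ty (map ι (roots F′)) ≡ rootTypes′ s
  ι-root-types s F′ typed′ = trans (sym (map-∘ (roots F′))) (root-types typed′)

  ι-kid-types : ∀ s F′ → Typed′ s F′ → ∀ y → map ty (map ι (lookup (kids F′) y)) ≡ childTypes′ s (ι y)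
  ι-kid-types s F′ typed′ y = trans (sym (map-∘ (lookup (kids F′) y))) (kid-types typed′ y)

  ι-kid-types-here : ∀ y p F′ → Typed′ (kidSlot (ι y) p) F′ →
                     map ty (map ι (lookup (kids F′) y)) ≡ (childTypes w (ι y) ─ p)
  ι-kid-types-here y p F′ typed′ = trans (ι-kid-types (kidSlot (ι y) p) F′ typed′ y) (childTypes′-here (ι y) p)

  roots⁺-types : ∀ s F′ → Typed′ s F′ → map ty (roots⁺ s (roots F′)) ≡ w0
  roots⁺-types (rootSlot p)  F′ typed′ = map-insertAt⁺ ty p (ι-root-types (rootSlot p) F′ typed′) refl
  roots⁺-types (kidSlot u p) F′ typed′ = ι-root-types (kidSlot u p) F′ typed′

  kid-types⁺ : ∀ s F′ → Typed′ s F′ → ∀ x → map ty (lookup (kids (insertLeaf s F′)) x) ≡ childTypes w x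
  kid-types⁺ s F′ typed′ x rewrite lookup-insertLeaf s F′ x with vertex x
  ... | the-leaf rewrite kids⁺-v s F′ = sym leaf
  ... | other y rewrite kids⁺-ι s F′ y with slotUnder s (ι y)
  ...   | slot-here p refl rewrite insertKid-here (ι y) p (map ι (lookup (kids F′) y)) =
            map-insertAt⁺ ty p (ι-kid-types-here y p F′ typed′) refl
  ...   | slot-elsewhere ins≡ types≡ _ rewrite ins≡ (map ι (lookup (kids F′) y)) =
            trans (ι-kid-types s F′ typed′ y) types≡

  occ-ι-roots⁺ : ∀ s r x → occ (ι x) (roots⁺ s r) ≡ occ x r
  occ-ι-roots⁺ (rootSlot p)  r x = occ-ι-insertAt-v p x r
  occ-ι-roots⁺ (kidSlot _ _) r x = occ-ι-map-ι x r

  occ-ι-insertKid : ∀ s x y xs → occ (ι x) (insertKid s y (map ι xs)) ≡ occ x xs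
  occ-ι-insertKid s x y xs with slotUnder s y
  ... | slot-here p refl rewrite insertKid-here y p (map ι xs) = occ-ι-insertAt-v p x xs
  ... | slot-elsewhere ins≡ _ _ rewrite ins≡ (map ι xs)     = occ-ι-map-ι x xs

  sum-occ-kids⁺ : ∀ s F′ x → ∑[ i < suc n ] occ x (lookup (kids (insertLeaf s F′)) i)
                            ≡ ∑[ y < n ] occ x (insertKid s (ι y) (map ι (lookup (kids F′) y)))
  sum-occ-kids⁺ s F′ x = begin
    ∑[ i < suc n ] occ x (lookup (kids (insertLeaf s F′)) i)
      ≡⟨ sum-remove {i = v} (λ i → occ x (lookup (kids (insertLeaf s F′)) i)) ⟩
    occ x (lookup (kids (insertLeaf s F′)) v) + ∑[ y < n ] occ x (lookup (kids (insertLeaf s F′)) (ι y))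
      ≡⟨ cong₂ _+_ (cong (occ x) (trans (lookup-insertLeaf s F′ v) (kids⁺-v s F′)))
                   (sum-cong-≗ (λ y → cong (occ x) (lookup-insertLeaf-ι s F′ y))) ⟩
    ∑[ y < n ] occ x (insertKid s (ι y) (map ι (lookup (kids F′) y)))
      ∎
    where open ≡-Reasoning

  one-parent⁺ : ∀ s F′ → Typed′ s F′ → ∀ x →
                occ x (roots⁺ s (roots F′)) + ∑[ i < suc n ] occ x (lookup (kids (insertLeaf s F′)) i) ≡ 1
  one-parent⁺ s F′ typed′ x rewrite sum-occ-kids⁺ s F′ x with vertex x
  ... | other x′ rewrite occ-ι-roots⁺ s (roots F′) x′ =
    trans (cong (occ x′ (roots F′) +_) (sum-cong-≗ (λ y → occ-ι-insertKid s x′ (ι y) (lookup (kids F′) y))))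
          (one-parent typed′ x′)
  ... | the-leaf with s
  ...   | rootSlot p rewrite occ-v-insertAt-v p (roots F′) =
            cong suc (sum-zero _ (λ y → occ-v-map-ι (lookup (kids F′) y)))
  ...   | kidSlot u p rewrite occ-v-map-ι (roots F′) with vertex u
  ...     | the-leaf = ⊥-elim (leaf-no-slot p)
  ...     | other u′ = trans (sum-concentrated _ u′ elsewhere) at-u′
    where
      at-u′ : occ v (insertKid (kidSlot (ι u′) p) (ι u′) (map ι (lookup (kids F′) u′))) ≡ 1
      at-u′ rewrite insertKid-here (ι u′) p (map ι (lookup (kids F′) u′)) = occ-v-insertAt-v p _
      elsewhere : ∀ y → u′ ≢ y → occ v (insertKid (kidSlot (ι u′) p) (ι y) (map ι (lookup (kids F′) y))) ≡ 0
      elsewhere y u′≢y with slotUnder (kidSlot (ι u′) p) (ι y)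
      ... | slot-here _ eq = ⊥-elim (u′≢y (punchIn-injective v u′ y (cong proj₁ (inj₂-injective eq))))
      ... | slot-elsewhere ins≡ _ _ rewrite ins≡ (map ι (lookup (kids F′) y)) = occ-v-map-ι (lookup (kids F′) y)

  ∈-insertKid : ∀ s y xs {z} → z ∈ xs → z ∈ insertKid s y xs
  ∈-insertKid s y xs z∈ with slotUnder s y
  ... | slot-here p refl rewrite insertKid-here y p xs = ∈-insertAt⁺ p xs z∈
  ... | slot-elsewhere ins≡ _ _ rewrite ins≡ xs        = z∈

  ∈-kids⁺ : ∀ s F′ {x} y → x ∈ lookup (kids F′) y → ι x ∈ lookup (kids (insertLeaf s F′)) (ι y)
  ∈-kids⁺ s F′ y x∈ = subst (_ ∈_) (sym (lookup-insertLeaf-ι s F′ y)) (∈-insertKid s (ι y) _ (∈-map⁺ ι x∈))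

  ∈-roots⁺ : ∀ s r {x} → x ∈ r → ι x ∈ roots⁺ s r
  ∈-roots⁺ (rootSlot p)  r x∈ = ∈-insertAt⁺ p (map ι r) (∈-map⁺ ι x∈)
  ∈-roots⁺ (kidSlot _ _) r x∈ = ∈-map⁺ ι x∈

  Reachable-ι : ∀ s F′ {xs′ xs} → (∀ {y} → y ∈ xs′ → ι y ∈ xs) →
                ∀ {y} → Reachable (kids F′) xs′ y → Reachable (kids (insertLeaf s F′)) xs (ι y)
  Reachable-ι s F′ ι∈ (root y∈)         = root (ι∈ y∈)
  Reachable-ι s F′ ι∈ (step {y = z} r y∈) = step (Reachable-ι s F′ ι∈ r) (∈-kids⁺ s F′ z y∈)

  reachable⁺ : ∀ s F′ → Typed′ s F′ → ∀ x → Reachable (kids (insertLeaf s F′)) (roots⁺ s (roots F′)) x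
  reachable⁺ s F′ typed′ x with vertex x
  ... | other y = Reachable-ι s F′ (∈-roots⁺ s (roots F′)) (reachable typed′ y)
  ... | the-leaf with s
  ...   | rootSlot p  = root (∈-insertAt-self p v _)
  ...   | kidSlot u p with vertex u
  ...     | the-leaf = ⊥-elim (leaf-no-slot p)
  ...     | other u′ = step (Reachable-ι (kidSlot (ι u′) p) F′ (∈-roots⁺ (kidSlot (ι u′) p) (roots F′)) (reachable typed′ u′)) v∈
    where
      v∈ : v ∈ lookup (kids (insertLeaf (kidSlot (ι u′) p) F′)) (ι u′)
      v∈ rewrite lookup-insertLeaf-ι (kidSlot (ι u′) p) F′ u′ | insertKid-here (ι u′) p (map ι (lookup (kids F′) u′)) =
        ∈-insertAt-self p v _

  insertLeaf-typed : ∀ s F′ → Typed′ s F′ → Typed (insertLeaf s F′)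
  insertLeaf-typed s F′ typed′ = record
    { one-parent = one-parent⁺ s F′ typed′
    ; reachable  = reachable⁺ s F′ typed′
    ; root-types = roots⁺-types s F′ typed′
    ; kid-types  = kid-types⁺ s F′ typed′
    }

  insertLeaf-at : ∀ s F′ → Typed′ s F′ → LeafAt s (insertLeaf s F′)
  insertLeaf-at (rootSlot p) F′ typed′ = nth-insertAt ty p v _ (ι-root-types (rootSlot p) F′ typed′)
  insertLeaf-at (kidSlot u p) F′ typed′ with vertex u
  ... | the-leaf = ⊥-elim (leaf-no-slot p)
  ... | other u′ rewrite lookup-insertLeaf-ι (kidSlot (ι u′) p) F′ u′
                       | insertKid-here (ι u′) p (map ι (lookup (kids F′) u′)) =
    nth-insertAt ty p v _ (ι-kid-types-here u′ p F′ typed′)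

  strip-insertKid : ∀ s x xs → strip (insertKid s x xs) ≡ strip xs
  strip-insertKid s x xs with slotUnder s x
  ... | slot-here p refl rewrite insertKid-here x p xs = strip-insertAt p xs
  ... | slot-elsewhere ins≡ _ _ rewrite ins≡ xs        = refl

  removeLeaf∘insertLeaf : ∀ s F′ → removeLeaf (insertLeaf s F′) ≡ F′
  removeLeaf∘insertLeaf s F′ = cong₂ mkPF (strip-roots⁺ s) (trans (tabulate-cong strip-kids) (tabulate∘lookup (kids F′)))
    where
      strip-roots⁺ : ∀ s → strip (roots⁺ s (roots F′)) ≡ roots F′
      strip-roots⁺ (rootSlot p)  = trans (strip-insertAt p _) (strip-map-ι _)
      strip-roots⁺ (kidSlot _ _) = strip-map-ι _
      strip-kids : ∀ y → strip (lookup (kids (insertLeaf s F′)) (ι y)) ≡ lookup (kids F′) y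
      strip-kids y rewrite lookup-insertLeaf-ι s F′ y = trans (strip-insertKid s (ι y) _) (strip-map-ι _)

  private
    +≡1⇒ : ∀ {a b} → a + b ≡ 1 → 1 ≤ a → a ≡ 1 × b ≡ 0
    +≡1⇒ {suc a} {b} a+b≡1 _ = let a+b≡0 = suc-injective a+b≡1 in cong suc (m+n≡0⇒m≡0 a a+b≡0) , m+n≡0⇒n≡0 a a+b≡0

    sum≡1⇒ : ∀ {m} (f : Fin (suc m) → ℕ) {u} → sum f ≡ 1 → 1 ≤ f u → f u ≡ 1 × (∀ x → u ≢ x → f x ≡ 0)
    sum≡1⇒ f {u} sum≡1 1≤fu =
        ≤-antisym (≤-trans (≤-sum f u) (≤-reflexive sum≡1)) 1≤fu
      , λ x u≢x → proj₂ (+≡1⇒ (≤-antisym (≤-trans (two≤-sum f u≢x) (≤-reflexive sum≡1))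
                                         (≤-trans 1≤fu (m≤m+n (f u) (f x)))) 1≤fu)

  module Occurrences (F : PlaneForestData (suc n)) (typed : Typed F) where

    occ-kids : Fin (suc n) → ℕ
    occ-kids x = occ v (lookup (kids F) x)

    at-root : ∀ p → LeafAt (rootSlot p) F → occ v (roots F) ≡ 1 × (∀ x → occ-kids x ≡ 0)
    at-root p at =
      let roots≡1 , sum≡0 = +≡1⇒ (one-parent typed v) (∈⇒occ≥1 (nth⇒∈ (idx p) (roots F) at))
      in roots≡1 , λ x → n≤0⇒n≡0 (≤-trans (≤-sum occ-kids x) (≤-reflexive sum≡0))

    at-kid : ∀ u p → LeafAt (kidSlot u p) F → occ v (roots F) ≡ 0 × occ-kids u ≡ 1 × (∀ x → u ≢ x → occ-kids x ≡ 0)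
    at-kid u p at =
      let 1≤u = ∈⇒occ≥1 (nth⇒∈ (idx p) (lookup (kids F) u) at)
          sum≡1 , roots≡0 = +≡1⇒ (trans (+-comm (sum occ-kids) (occ v (roots F))) (one-parent typed v)) (≤-trans 1≤u (≤-sum occ-kids u))
          u≡1 , others≡0 = sum≡1⇒ occ-kids sum≡1 1≤u
      in roots≡0 , u≡1 , others≡0

    elsewhere : ∀ s → LeafAt s F → ∀ x → (∀ p → s ≢ kidSlot x p) → occ-kids x ≡ 0
    elsewhere (rootSlot p)  at x _      = proj₂ (at-root p at) x
    elsewhere (kidSlot u p) at x not-x with u ≟ x
    ... | yes refl = ⊥-elim (not-x p refl)
    ... | no u≢x  = proj₂ (proj₂ (at-kid u p at)) x u≢x

    kids-v : lookup (kids F) v ≡ []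
    kids-v = map≡[]⇒≡[] ty _ (trans (kid-types typed v) leaf)

  leafSlot : ∀ F → Typed F → Σ Slot (λ s → LeafAt s F)
  leafSlot F typed with Any.any? (v ≟_) (roots F)
  ... | yes v∈ = let p , idx≡ = idx-map⁺ ty v∈ in
    rootSlot (subst (t ∈_) (root-types typed) p) ,
    subst (λ k → nth k (roots F) ≡ just v) (sym (trans (idx-subst (root-types typed) p) idx≡)) (nth-idx v∈)
  ... | no v∉roots with any? (λ u → Any.any? (v ≟_) (lookup (kids F) u))
  ...   | yes (u , v∈) = let p , idx≡ = idx-map⁺ ty v∈ in
    kidSlot u (subst (t ∈_) (kid-types typed u) p) ,
    subst (λ k → nth k (lookup (kids F) u) ≡ just v) (sym (trans (idx-subst (kid-types typed u) p) idx≡)) (nth-idx v∈)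
  ...   | no v∉kids = ⊥-elim (0≢1+n (trans (sym no-occ) (one-parent typed v)))
    where
      no-occ : occ v (roots F) + ∑[ i < suc n ] occ v (lookup (kids F) i) ≡ 0
      no-occ = cong₂ _+_ (∉⇒occ≡0 (roots F) v∉roots) (sum-zero _ (λ u → ∉⇒occ≡0 _ (λ v∈ → v∉kids (u , v∈))))

  leafSlot-unique : ∀ F → Typed F → ∀ s s′ → LeafAt s F → LeafAt s′ F → s ≡ s′
  leafSlot-unique F typed (rootSlot p) (rootSlot p′) at at′ with idx p ≟ℕ idx p′
  ... | yes idx≡ = cong rootSlot (idx-injective p p′ idx≡)
  ... | no idx≢ = ⊥-elim (1+n≰n (≤-trans (nth-twice⇒occ≥2 _ _ (roots F) at at′ idx≢) (≤-reflexive (proj₁ (at-root p at)))))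
    where open Occurrences F typed
  leafSlot-unique F typed (rootSlot p) (kidSlot u′ p′) at at′ =
    ⊥-elim (1+n≢0 (trans (sym (proj₁ (at-root p at))) (proj₁ (at-kid u′ p′ at′))))
    where open Occurrences F typed
  leafSlot-unique F typed (kidSlot u p) (rootSlot p′) at at′ =
    ⊥-elim (1+n≢0 (trans (sym (proj₁ (at-root p′ at′))) (proj₁ (at-kid u p at))))
    where open Occurrences F typed
  leafSlot-unique F typed (kidSlot u p) (kidSlot u′ p′) at at′ with u ≟ u′
  ... | no u≢u′ = ⊥-elim (1+n≰n (≤-trans (∈⇒occ≥1 (nth⇒∈ (idx p′) (lookup (kids F) u′) at′))
                                          (≤-reflexive (proj₂ (proj₂ (at-kid u p at)) u′ u≢u′))))
    where open Occurrences F typed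
  ... | yes refl with idx p ≟ℕ idx p′
  ...   | yes idx≡ = cong (kidSlot u) (idx-injective p p′ idx≡)
  ...   | no idx≢ = ⊥-elim (1+n≰n (≤-trans (nth-twice⇒occ≥2 _ _ (lookup (kids F) u) at at′ idx≢)
                                           (≤-reflexive (proj₁ (proj₂ (at-kid u p at))))))
    where open Occurrences F typed

  insertLeaf∘removeLeaf : ∀ F → Typed F → ∀ s → LeafAt s F → insertLeaf s (removeLeaf F) ≡ F
  insertLeaf∘removeLeaf F typed s at = cong₂ mkPF (roots≡ s at) (trans (tabulate-cong kids≡) (tabulate∘lookup (kids F)))
    where
      open Occurrences F typed
      roots≡ : ∀ s → LeafAt s F → roots⁺ s (strip (roots F)) ≡ roots F
      roots≡ (rootSlot p)  at = insertAt-map-ι-strip p (roots F) at (proj₁ (at-root p at))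
      roots≡ (kidSlot u p) at = map-ι-strip (roots F) (proj₁ (at-kid u p at))
      kids≡ : ∀ x → kids⁺ s (removeLeaf F) x ≡ lookup (kids F) x
      kids≡ x with vertex x
      ... | the-leaf = trans (kids⁺-v s (removeLeaf F)) (sym kids-v)
      ... | other y rewrite kids⁺-ι s (removeLeaf F) y | lookup-removeLeaf F y with slotUnder s (ι y)
      ...   | slot-here p refl rewrite insertKid-here (ι y) p (map ι (strip (lookup (kids F) (ι y)))) =
                insertAt-map-ι-strip p _ at (proj₁ (proj₂ (at-kid (ι y) p at)))
      ...   | slot-elsewhere ins≡ _ not-here rewrite ins≡ (map ι (strip (lookup (kids F) (ι y)))) =
                map-ι-strip _ (elsewhere s at (ι y) not-here)

  Reachable-strip : ∀ F → Typed F → ∀ {xs xs′} → (∀ {x} → x ∈ xs → (v≢x : v ≢ x) → punchOut v≢x ∈ xs′) →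
                    ∀ {x} → Reachable (kids F) xs x → (v≢x : v ≢ x) → Reachable (kids (removeLeaf F)) xs′ (punchOut v≢x)
  Reachable-strip F typed strip∈ (root x∈) v≢x = root (strip∈ x∈ v≢x)
  Reachable-strip F typed strip∈ (step {y = y} r x∈) v≢x with v ≟ y
  ... | yes refl = ⊥-elim (¬Any[] (subst (_ ∈_) (Occurrences.kids-v F typed) x∈))
  ... | no v≢y  = step (Reachable-strip F typed strip∈ r v≢y) x∈′
    where
      x∈′ : punchOut v≢x ∈ lookup (kids (removeLeaf F)) (punchOut v≢y)
      x∈′ rewrite lookup-removeLeaf F (punchOut v≢y) | punchIn-punchOut v≢y = ∈-strip _ x∈ v≢x

  removeLeaf-typed : ∀ F → Typed F → ∀ s → LeafAt s F → Typed′ s (removeLeaf F)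
  removeLeaf-typed F typed s at = record
    { one-parent = one-parent′
    ; reachable  = λ y → subst (Reachable (kids (removeLeaf F)) (strip (roots F))) (punchOut-ι y (v≢ι y))
                             (Reachable-strip F typed (∈-strip _) (reachable typed (ι y)) (v≢ι y))
    ; root-types = trans (map-∘ (strip (roots F))) (root-types′ s at)
    ; kid-types  = λ y → trans (cong (map (ty ∘ ι)) (lookup-removeLeaf F y))
                               (trans (map-∘ (strip (lookup (kids F) (ι y)))) (kid-types′ y))
    }
    where
      open Occurrences F typed
      one-parent′ : ∀ y → occ y (strip (roots F)) + ∑[ i < n ] occ y (lookup (kids (removeLeaf F)) i) ≡ 1
      one-parent′ y = begin
        occ y (strip (roots F)) + ∑[ i < n ] occ y (lookup (kids (removeLeaf F)) i)
          ≡⟨ cong₂ _+_ (occ-strip y (roots F))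
                       (sum-cong-≗ (λ i → trans (cong (occ y) (lookup-removeLeaf F i)) (occ-strip y (lookup (kids F) (ι i))))) ⟩
        occ (ι y) (roots F) + ∑[ i < n ] occ (ι y) (lookup (kids F) (ι i))
          ≡⟨ cong (occ (ι y) (roots F) +_) (sym (trans (sum-remove {i = v} (λ x → occ (ι y) (lookup (kids F) x)))
                                                      (cong (λ l → occ (ι y) l + ∑[ i < n ] occ (ι y) (lookup (kids F) (ι i))) kids-v))) ⟩
        occ (ι y) (roots F) + ∑[ x < suc n ] occ (ι y) (lookup (kids F) x)
          ≡⟨ one-parent typed (ι y) ⟩
        1 ∎
        where open ≡-Reasoning
      root-types′ : ∀ s → LeafAt s F → map ty (map ι (strip (roots F))) ≡ rootTypes′ s
      root-types′ (rootSlot p) at =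
        map-insertAt⁻ ty p _ (trans (cong (map ty) (insertAt-map-ι-strip p (roots F) at (proj₁ (at-root p at)))) (root-types typed))
      root-types′ (kidSlot u p) at = trans (cong (map ty) (map-ι-strip (roots F) (proj₁ (at-kid u p at)))) (root-types typed)
      kid-types′ : ∀ y → map ty (map ι (strip (lookup (kids F) (ι y)))) ≡ childTypes′ s (ι y)
      kid-types′ y with slotUnder s (ι y)
      ... | slot-here p refl =
        trans (map-insertAt⁻ ty p _ (trans (cong (map ty) (insertAt-map-ι-strip p _ at (proj₁ (proj₂ (at-kid (ι y) p at)))))
                                           (kid-types typed (ι y))))
              (sym (childTypes′-here (ι y) p))
      ... | slot-elsewhere _ types≡ not-here =
        trans (cong (map ty) (map-ι-strip _ (elsewhere s at (ι y) not-here))) (trans (kid-types typed (ι y)) (sym types≡))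

  Forests↔ : Forests w0 w ↔ Σ Slot (λ s → Forests (rootTypes′ s) (w′ s))
  Forests↔ = mk↔ₛ′ to from to∘from from∘to
    where
      to : Forests w0 w → Σ Slot (λ s → Forests (rootTypes′ s) (w′ s))
      to (F , tF) = let typed = T⇒IsTypedForest tF ; s , at = leafSlot F typed in
        s , removeLeaf F , IsTypedForest⇒T (removeLeaf-typed F typed s at)
      from : Σ Slot (λ s → Forests (rootTypes′ s) (w′ s)) → Forests w0 w
      from (s , F′ , tF′) = insertLeaf s F′ , IsTypedForest⇒T (insertLeaf-typed s F′ (T⇒IsTypedForest tF′))
      pair-≡ : ∀ {s₁ s₂ F₁ F₂} {t₁ : T (isForest F₁ ∧ hasTypeArray (rootTypes′ s₁) (w′ s₁) F₁)}
                 {t₂ : T (isForest F₂ ∧ hasTypeArray (rootTypes′ s₂) (w′ s₂) F₂)} →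
               s₁ ≡ s₂ → F₁ ≡ F₂ → _≡_ {A = Σ Slot (λ s → Forests (rootTypes′ s) (w′ s))} (s₁ , F₁ , t₁) (s₂ , F₂ , t₂)
      pair-≡ {s₁} {F₁ = F₁} refl refl = cong (λ t → s₁ , F₁ , t) (T-irrelevant _ _)
      to∘from : ∀ y → to (from y) ≡ y
      to∘from (s , F′ , tF′) =
        let typed′ = T⇒IsTypedForest tF′
            typed  = T⇒IsTypedForest (IsTypedForest⇒T (insertLeaf-typed s F′ typed′))
            s′ , at′ = leafSlot (insertLeaf s F′) typed
        in pair-≡ (leafSlot-unique _ typed s′ s at′ (insertLeaf-at s F′ typed′)) (removeLeaf∘insertLeaf s F′)
      from∘to : ∀ x → from (to x) ≡ x
      from∘to (F , tF) = let typed = T⇒IsTypedForest tF ; s , at = leafSlot F typed in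
        Σ-≡,≡→≡ (insertLeaf∘removeLeaf F typed s at , T-irrelevant _ _)

T-∧-∧⁻ : ∀ {a b c} → T (a ∧ b ∧ c) → T (a ∧ b) × T c
T-∧-∧⁻ {true} {true} {true} _ = _ , _

T-∧-∧⁺ : ∀ {a b c} → T (a ∧ b) → T c → T (a ∧ b ∧ c)
T-∧-∧⁺ {true} {true} {true} _ _ = _

Reachable-childless : ∀ {n} (ks : Vec (List (Fin n)) n) x₀ → lookup ks x₀ ≡ [] → ∀ {x} → Reachable ks (x₀ ∷ []) x → x ≡ x₀
Reachable-childless ks x₀ childless (root (here x≡x₀)) = x≡x₀
Reachable-childless ks x₀ childless (step r x∈) rewrite Reachable-childless ks x₀ childless r =
  ⊥-elim (¬Any[] (subst (_ ∈_) childless x∈))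

-- Vertex 1 is `zero`; the removed leaf is suc j.

module LeafRemovalFirst {m : ℕ} (h : Ty) (w0t : List Ty) (w : Fin (suc (suc m)) → Ty × List Ty)
                        (j : Fin (suc m)) (leaf : childTypes w (suc j) ≡ []) where

  open LeafRemoval (h ∷ w0t) w (suc j) leaf

  Slot₁ : Set
  Slot₁ = SlotIn w0t

  embed : Slot₁ → Slot
  embed (inj₁ p) = rootSlot (there p)
  embed (inj₂ x) = inj₂ x

  FirstRoot : Slot → Set
  FirstRoot (rootSlot (here _)) = ⊤
  FirstRoot _                   = ⊥

  unembed : (s : Slot) → ¬ FirstRoot s → Slot₁
  unembed (rootSlot (here _))  ¬first = ⊥-elim (¬first tt)
  unembed (rootSlot (there p)) _      = inj₁ p
  unembed (inj₂ x)             _      = inj₂ x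

  unembed-embed : ∀ s ¬first s₁ → embed s₁ ≡ s → unembed s ¬first ≡ s₁
  unembed-embed _ _ (inj₁ p) refl = refl
  unembed-embed _ _ (inj₂ x) refl = refl

  embed-unembed : ∀ s ¬first → embed (unembed s ¬first) ≡ s
  embed-unembed (rootSlot (here _))  ¬first = ⊥-elim (¬first tt)
  embed-unembed (rootSlot (there p)) _      = refl
  embed-unembed (inj₂ x)             _      = refl

  ∈-first-roots⁺ : ∀ s₁ r {y} → y ∈ take 1 r → ι y ∈ take 1 (roots⁺ (embed s₁) r)
  ∈-first-roots⁺ (inj₁ p) (y ∷ r) (here refl) = here refl
  ∈-first-roots⁺ (inj₂ _) (y ∷ r) (here refl) = here refl

  ∈-first-strip : ∀ r {x} → x ∈ take 1 r → (v≢x : suc j ≢ x) → punchOut v≢x ∈ take 1 (strip r)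
  ∈-first-strip (x ∷ r) (here refl) v≢x with suc j ≟ x
  ... | yes v≡x = ⊥-elim (v≢x v≡x)
  ... | no v≢x′  = here (punchOut-cong (suc j) {i≢j = v≢x} {i≢k = v≢x′} refl)

  not-first-root : ∀ F → Typed F → ∀ s → LeafAt s F → Reachable (kids F) (take 1 (roots F)) zero → ¬ FirstRoot s
  not-first-root F typed (rootSlot (here refl)) at first with roots F | at
  ... | x ∷ r | refl with Reachable-childless (kids F) (suc j) (Occurrences.kids-v F typed) first
  ...   | ()

  ForestsFirst↔ : ForestsFirst (h ∷ w0t) w ↔ Σ Slot₁ (λ s₁ → ForestsFirst (rootTypes′ (embed s₁)) (w′ (embed s₁)))
  ForestsFirst↔ = mk↔ₛ′ to from to∘from from∘to
    where
      Target = Σ Slot₁ (λ s₁ → ForestsFirst (rootTypes′ (embed s₁)) (w′ (embed s₁)))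

      module Decompose (F : PlaneForestData (suc (suc m))) (tF : T (isForest F ∧ hasTypeArray (h ∷ w0t) w F ∧ inFirstTree zero F)) where
        typed : Typed F
        typed = T⇒IsTypedForest (proj₁ (T-∧-∧⁻ {isForest F} tF))
        first : Reachable (kids F) (take 1 (roots F)) zero
        first = T-inFirstTree⁻ F (proj₂ (T-∧-∧⁻ {isForest F} tF))
        slot : Slot
        slot = proj₁ (leafSlot F typed)
        ¬first : ¬ FirstRoot slot
        ¬first = not-first-root F typed slot (proj₂ (leafSlot F typed)) first
        slot₁ : Slot₁
        slot₁ = unembed slot ¬first
        at : LeafAt (embed slot₁) F
        at = subst (λ s → LeafAt s F) (sym (embed-unembed slot ¬first)) (proj₂ (leafSlot F typed))

      to : ForestsFirst (h ∷ w0t) w → Target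
      to (F , tF) = slot₁ , removeLeaf F ,
        T-∧-∧⁺ {isForest (removeLeaf F)} (IsTypedForest⇒T (removeLeaf-typed F typed (embed slot₁) at))
          (T-inFirstTree⁺ (removeLeaf F) (Reachable-strip F typed (∈-first-strip (roots F)) first (λ ())))
        where open Decompose F tF

      from : Target → ForestsFirst (h ∷ w0t) w
      from (s₁ , F′ , tF′) = insertLeaf (embed s₁) F′ ,
        T-∧-∧⁺ {isForest (insertLeaf (embed s₁) F′)} (IsTypedForest⇒T (insertLeaf-typed (embed s₁) F′ typed′))
          (T-inFirstTree⁺ (insertLeaf (embed s₁) F′)
            (Reachable-ι (embed s₁) F′ (∈-first-roots⁺ s₁ (roots F′)) (T-inFirstTree⁻ F′ (proj₂ (T-∧-∧⁻ {isForest F′} tF′)))))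
        where typed′ = T⇒IsTypedForest (proj₁ (T-∧-∧⁻ {isForest F′} tF′))

      pair-≡ : ∀ {s₁ s₂ F₁ F₂} {t₁ : T (isForest F₁ ∧ hasTypeArray (rootTypes′ (embed s₁)) (w′ (embed s₁)) F₁ ∧ inFirstTree zero F₁)}
                 {t₂ : T (isForest F₂ ∧ hasTypeArray (rootTypes′ (embed s₂)) (w′ (embed s₂)) F₂ ∧ inFirstTree zero F₂)} →
               s₁ ≡ s₂ → F₁ ≡ F₂ → _≡_ {A = Target} (s₁ , F₁ , t₁) (s₂ , F₂ , t₂)
      pair-≡ {s₁} {F₁ = F₁} refl refl = cong (λ t → s₁ , F₁ , t) (T-irrelevant _ _)

      to∘from : ∀ y → to (from y) ≡ y
      to∘from (s₁ , F′ , tF′) =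
        pair-≡ (unembed-embed slot ¬first s₁ (leafSlot-unique F typed (embed s₁) slot
                   (insertLeaf-at (embed s₁) F′ (T⇒IsTypedForest (proj₁ (T-∧-∧⁻ {isForest F′} tF′))))
                   (proj₂ (leafSlot F typed))))
               (removeLeaf∘insertLeaf (embed s₁) F′)
        where
          F  = proj₁ (from (s₁ , F′ , tF′))
          open Decompose F (proj₂ (from (s₁ , F′ , tF′)))

      from∘to : ∀ x → from (to x) ≡ x
      from∘to (F , tF) = Σ-≡,≡→≡ (insertLeaf∘removeLeaf F typed (embed slot₁) at , T-irrelevant _ _)
        where open Decompose F tF

Fin-cong : ∀ {m n} → m ≡ n → Fin m ↔ Fin n
Fin-cong refl = ↔-refl

Σ-cong : ∀ {X : Set} {P Q : X → Set} → (∀ x → P x ↔ Q x) → Σ X P ↔ Σ X Q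
Σ-cong P↔Q = Σ-↔ ↔-refl (P↔Q _)

Σ-Fin-suc↔ : ∀ {n} (P : Fin (suc n) → Set) → Σ (Fin (suc n)) P ↔ (P zero ⊎ Σ (Fin n) (P ∘ suc))
Σ-Fin-suc↔ P = mk↔ₛ′ (λ { (zero , p) → inj₁ p ; (suc i , p) → inj₂ (i , p) })
                     (λ { (inj₁ p) → zero , p ; (inj₂ (i , p)) → suc i , p })
                     (λ { (inj₁ _) → refl ; (inj₂ _) → refl })
                     (λ { (zero , _) → refl ; (suc _ , _) → refl })

Σ-Fin↔Fin-sum : ∀ {n} (k : Fin n → ℕ) → Σ (Fin n) (Fin ∘ k) ↔ Fin (sum k)
Σ-Fin↔Fin-sum {zero}  k = mk↔ₛ′ (λ { (() , _) }) (λ ()) (λ ()) (λ { (() , _) })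
Σ-Fin↔Fin-sum {suc n} k =
  ↔-trans (Σ-Fin-suc↔ (Fin ∘ k)) (↔-trans (↔-refl ⊎-↔ Σ-Fin↔Fin-sum (k ∘ suc)) (↔-sym (+↔⊎ {k zero})))

positions×Fin↔ : ∀ t ts k → (t ∈ ts × Fin k) ↔ Fin (countTy t ts * k)
positions×Fin↔ t ts k = ↔-trans (positions↔ t ts ×-↔ ↔-refl) (↔-sym (*↔× {countTy t ts}))

-- The counting formulas

forestCount : (a b aᴼ bᴼ aᴮ bᴬ : ℕ) → ℕ
forestCount zero    zero    _  _  _  _  = 1
forestCount (suc a) zero    aO _  _  _  = aO * a !
forestCount zero    (suc b) _  bO _  _  = bO * b !
forestCount (suc a) (suc b) aO bO aB bA = (aO * bO + aO * bA + aB * bO) * a ! * b !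

firstTreeCount : (h : Ty) (a b bᴼ aᴮ bᴬ : ℕ) → ℕ
firstTreeCount h a zero    _  _  _  = (a ∸ 1) !
firstTreeCount A a (suc b) bO aB bA = (bO + bA) * (a ∸ 1) ! * b !
firstTreeCount B a (suc b) bO aB bA = aB * (a ∸ 1) ! * b !

forestCount-swap : ∀ a b aO bO aB bA → forestCount a b aO bO aB bA ≡ forestCount b a bO aO bA aB
forestCount-swap zero    zero    aO bO aB bA = refl
forestCount-swap (suc a) zero    aO bO aB bA = refl
forestCount-swap zero    (suc b) aO bO aB bA = refl
forestCount-swap (suc a) (suc b) aO bO aB bA = swap aO bO aB bA (a !) (b !)
  where
    swap : ∀ aO bO aB bA F G → (aO * bO + aO * bA + aB * bO) * F * G ≡ (bO * aO + bO * aB + bA * aO) * G * F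
    swap = solve-∀

-- The root-slot term x * f (x ∸ 1) of the recurrences is handled by this
-- consequence of f being affine.
private
  *-affine-pred : ∀ (f : ℕ → ℕ) d → (∀ y → f (suc y) ≡ d + f y) → ∀ x → x * f (x ∸ 1) + x * d ≡ x * f x
  *-affine-pred f d f-suc zero    = refl
  *-affine-pred f d f-suc (suc y) =
    trans (sym (*-distribˡ-+ (suc y) (f y) d)) (cong (suc y *_) (trans (+-comm (f y) d) (sym (f-suc y))))

forestCount-stepA : ∀ a₁ b aO aA aB bO bA → suc a₁ ≡ aO + aA + aB →
                    (a₁ ≡ 0 → aA ≡ 0) → (a₁ ≡ 0 → bA ≡ 0) → (b ≡ 0 → aB ≡ 0) →
                    aO * forestCount a₁ b (aO ∸ 1) bO aB bA
                      + (aA * forestCount a₁ b aO bO aB bA + aB * forestCount a₁ b aO bO (aB ∸ 1) bA)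
                    ≡ forestCount (suc a₁) b aO bO aB bA
forestCount-stepA zero zero aO aA aB bO bA a≡ aA≡0 _ aB≡0 rewrite aA≡0 refl | aB≡0 refl = identity aO
  where identity : ∀ aO → aO * 1 + 0 ≡ aO * 1
        identity = solve-∀
forestCount-stepA zero (suc b₁) aO aA aB bO bA a≡ aA≡0 bA≡0 _ rewrite aA≡0 refl | bA≡0 refl = identity aO aB bO (b₁ !)
  where identity : ∀ aO aB bO G → aO * (bO * G) + (0 + aB * (bO * G)) ≡ (aO * bO + aO * 0 + aB * bO) * 1 * G
        identity = solve-∀
forestCount-stepA (suc a₂) zero aO aA aB bO bA a≡ _ _ aB≡0 rewrite aB≡0 refl = +-cancelʳ-≡ (aO * F) _ _ (begin
  aO * ((aO ∸ 1) * F) + (aA * (aO * F) + 0 * (0 * F)) + aO * F ≡⟨ regroup aO aA F ((aO ∸ 1) * F) ⟩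
  (aO * ((aO ∸ 1) * F) + aO * F) + aA * (aO * F)             ≡⟨ cong (_+ aA * (aO * F)) (*-affine-pred (_* F) F (λ _ → refl) aO) ⟩
  aO * (aO * F) + aA * (aO * F)                               ≡⟨ *-distribʳ-+ (aO * F) aO aA ⟨
  (aO + aA) * (aO * F)                                        ≡⟨ cong (_* (aO * F)) (trans (sym (+-identityʳ (aO + aA))) (sym a≡)) ⟩
  suc (suc a₂) * (aO * F)                                     ≡⟨ finish aO a₂ F ⟩
  aO * (suc a₂ * F) + aO * F                                  ∎)
  where
    open ≡-Reasoning
    F = a₂ !
    regroup : ∀ aO aA F p → aO * p + (aA * (aO * F) + 0 * (0 * F)) + aO * F ≡ (aO * p + aO * F) + aA * (aO * F)
    regroup = solve-∀
    finish : ∀ aO a₂ F → suc (suc a₂) * (aO * F) ≡ aO * (suc a₂ * F) + aO * F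
    finish = solve-∀
forestCount-stepA (suc a₂) (suc b₁) aO aA aB bO bA a≡ _ _ _ = +-cancelʳ-≡ XFG _ _ (begin
  aO * fO (aO ∸ 1) + (aA * XFG + aB * fB (aB ∸ 1)) + XFG
    ≡⟨ regroup aO aA aB bO bA F G (fO (aO ∸ 1)) (fB (aB ∸ 1)) ⟩
  (aO * fO (aO ∸ 1) + aO * dO) + aA * XFG + (aB * fB (aB ∸ 1) + aB * dB)
    ≡⟨ cong₂ (λ x y → x + aA * XFG + y) (*-affine-pred fO dO (fO-suc aB bO bA F G) aO)
                                         (*-affine-pred fB dB (fB-suc aO bO bA F G) aB) ⟩
  aO * XFG + aA * XFG + aB * XFG
    ≡⟨ distrib aO aA aB XFG ⟩
  (aO + aA + aB) * XFG
    ≡⟨ cong (_* XFG) (sym a≡) ⟩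
  suc (suc a₂) * XFG
    ≡⟨ finish X a₂ F G ⟩
  X * (suc a₂ * F) * G + XFG
    ∎)
  where
    open ≡-Reasoning
    F = a₂ !
    G = b₁ !
    X = aO * bO + aO * bA + aB * bO
    XFG = X * F * G
    fO fB : ℕ → ℕ
    fO y = (y * bO + y * bA + aB * bO) * F * G
    fB y = (aO * bO + aO * bA + y * bO) * F * G
    dO = (bO + bA) * F * G
    dB = bO * F * G
    fO-suc : ∀ aB bO bA F G y → (suc y * bO + suc y * bA + aB * bO) * F * G ≡ (bO + bA) * F * G + (y * bO + y * bA + aB * bO) * F * G
    fO-suc = solve-∀
    fB-suc : ∀ aO bO bA F G y → (aO * bO + aO * bA + suc y * bO) * F * G ≡ bO * F * G + (aO * bO + aO * bA + y * bO) * F * G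
    fB-suc = solve-∀
    regroup : ∀ aO aA aB bO bA F G p q →
              aO * p + (aA * ((aO * bO + aO * bA + aB * bO) * F * G) + aB * q) + (aO * bO + aO * bA + aB * bO) * F * G
              ≡ (aO * p + aO * ((bO + bA) * F * G)) + aA * ((aO * bO + aO * bA + aB * bO) * F * G) + (aB * q + aB * (bO * F * G))
    regroup = solve-∀
    distrib : ∀ x y z w → x * w + y * w + z * w ≡ (x + y + z) * w
    distrib = solve-∀
    finish : ∀ X a₂ F G → suc (suc a₂) * (X * F * G) ≡ X * (suc a₂ * F) * G + X * F * G
    finish = solve-∀

forestCount-stepB : ∀ a b₁ aO aB bO bA bB → suc b₁ ≡ bO + bA + bB →
                    (b₁ ≡ 0 → bB ≡ 0) → (b₁ ≡ 0 → aB ≡ 0) → (a ≡ 0 → bA ≡ 0) →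
                    bO * forestCount a b₁ aO (bO ∸ 1) aB bA
                      + (bA * forestCount a b₁ aO bO aB (bA ∸ 1) + bB * forestCount a b₁ aO bO aB bA)
                    ≡ forestCount a (suc b₁) aO bO aB bA
forestCount-stepB a b₁ aO aB bO bA bB b≡ bB≡0 aB≡0 bA≡0 = begin
  bO * C (bO ∸ 1) bA + (bA * C bO (bA ∸ 1) + bB * C bO bA)
    ≡⟨ cong (bO * C (bO ∸ 1) bA +_) (+-comm (bA * C bO (bA ∸ 1)) (bB * C bO bA)) ⟩
  bO * C (bO ∸ 1) bA + (bB * C bO bA + bA * C bO (bA ∸ 1))
    ≡⟨ cong₂ (λ x y → bO * x + y) (swap (bO ∸ 1) bA)
             (cong₂ (λ x y → bB * x + bA * y) (swap bO bA) (swap bO (bA ∸ 1))) ⟩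
  bO * C′ (bO ∸ 1) bA + (bB * C′ bO bA + bA * C′ bO (bA ∸ 1))
    ≡⟨ forestCount-stepA b₁ a bO bB bA aO aB (trans b≡ (x+y+z≡x+z+y bO bA bB)) bB≡0 aB≡0 bA≡0 ⟩
  forestCount (suc b₁) a bO aO bA aB
    ≡⟨ forestCount-swap (suc b₁) a bO aO bA aB ⟩
  forestCount a (suc b₁) aO bO aB bA
    ∎
  where
    open ≡-Reasoning
    C C′ : ℕ → ℕ → ℕ
    C  bO bA = forestCount a b₁ aO bO aB bA
    C′ bO bA = forestCount b₁ a bO aO bA aB
    swap : ∀ bO bA → C bO bA ≡ C′ bO bA
    swap bO bA = forestCount-swap a b₁ aO bO aB bA
    x+y+z≡x+z+y : ∀ x y z → x + y + z ≡ x + z + y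
    x+y+z≡x+z+y = solve-∀

byType : Ty → ℕ → ℕ → ℕ
byType A x y = x
byType B x y = y

countTy≡byType : ∀ t xs → countTy t xs ≡ byType t (countTy A xs) (countTy B xs)
countTy≡byType A xs = refl
countTy≡byType B xs = refl

-- aA and bB count the child slots of type A under vertices of type A and of
-- type B under type B; they complete the paper's aᴮ (here aB) and bᴬ (bA).
forestCount-step : ∀ t a b aO aA aB bO bA bB → a ≡ aO + (aA + aB) → b ≡ bO + (bA + bB) →
                   [ A ≡ᵗ t ] ≤ a → [ B ≡ᵗ t ] ≤ b →
                   (a ≡ [ A ≡ᵗ t ] → aA ≡ 0 × bA ≡ 0) → (b ≡ [ B ≡ᵗ t ] → aB ≡ 0 × bB ≡ 0) →
                   let a′ = a ∸ [ A ≡ᵗ t ] ; b′ = b ∸ [ B ≡ᵗ t ] in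
                   byType t aO bO * forestCount a′ b′ (aO ∸ [ A ≡ᵗ t ]) (bO ∸ [ B ≡ᵗ t ]) aB bA
                     + (byType t aA bA * forestCount a′ b′ aO bO aB (bA ∸ [ B ≡ᵗ t ])
                        + byType t aB bB * forestCount a′ b′ aO bO (aB ∸ [ A ≡ᵗ t ]) bA)
                   ≡ forestCount a b aO bO aB bA
forestCount-step A (suc a₁) b aO aA aB bO bA bB a≡ _ _ _ only-A only-B =
  forestCount-stepA a₁ b aO aA aB bO bA (trans a≡ (sym (+-assoc aO aA aB)))
    (λ a₁≡0 → proj₁ (only-A (cong suc a₁≡0))) (λ a₁≡0 → proj₂ (only-A (cong suc a₁≡0))) (λ b≡0 → proj₁ (only-B b≡0))
forestCount-step B a (suc b₁) aO aA aB bO bA bB _ b≡ _ _ only-A only-B =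
  forestCount-stepB a b₁ aO aB bO bA bB (trans b≡ (sym (+-assoc bO bA bB)))
    (λ b₁≡0 → proj₂ (only-B (cong suc b₁≡0))) (λ b₁≡0 → proj₁ (only-B (cong suc b₁≡0))) (λ a≡0 → proj₂ (only-A a≡0))

firstTreeCount-stepA : ∀ h a₂ b r aA aB bO bA → suc (suc a₂) ≡ [ A ≡ᵗ h ] + r + aA + aB →
                       (b ≡ 0 → aB ≡ 0) → (b ≡ 0 → h ≡ A) →
                       r * firstTreeCount h (suc a₂) b bO aB bA
                         + (aA * firstTreeCount h (suc a₂) b bO aB bA + aB * firstTreeCount h (suc a₂) b bO (aB ∸ 1) bA)
                       ≡ firstTreeCount h (suc (suc a₂)) b bO aB bA
firstTreeCount-stepA h a₂ zero r aA aB bO bA a≡ aB≡0 h≡A rewrite aB≡0 refl | h≡A refl =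
  trans (identity r aA (a₂ !)) (cong (_* a₂ !) (sym (suc-injective (trans a≡ (+-identityʳ _)))))
  where identity : ∀ r aA F → r * F + (aA * F + 0 * F) ≡ (r + aA) * F
        identity = solve-∀
firstTreeCount-stepA A a₂ (suc b₁) r aA aB bO bA a≡ _ _ =
  trans (identity r aA aB (bO + bA) (a₂ !) (b₁ !)) (cong (λ x → (bO + bA) * (x * a₂ !) * b₁ !) (sym (suc-injective a≡)))
  where identity : ∀ r aA aB X F G → r * (X * F * G) + (aA * (X * F * G) + aB * (X * F * G)) ≡ X * ((r + aA + aB) * F) * G
        identity = solve-∀
firstTreeCount-stepA B a₂ (suc b₁) r aA zero bO bA a≡ _ _ = identity r aA (a₂ !) (b₁ !)
  where identity : ∀ r aA F G → r * (0 * F * G) + (aA * (0 * F * G) + 0) ≡ 0 * (suc a₂ * F) * G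
        identity = solve-∀
firstTreeCount-stepA B a₂ (suc b₁) r aA (suc c) bO bA a≡ _ _ =
  trans (identity r aA c (a₂ !) (b₁ !)) (cong (λ x → suc c * (x * a₂ !) * b₁ !) (sym (suc-injective (trans a≡ (+-suc (r + aA) c)))))
  where identity : ∀ r aA c F G → r * (suc c * F * G) + (aA * (suc c * F * G) + suc c * (c * F * G)) ≡ suc c * ((r + aA + c) * F) * G
        identity = solve-∀

firstTreeCount-stepB : ∀ h a b₁ aB r bA bB → suc b₁ ≡ [ B ≡ᵗ h ] + r + bA + bB →
                       (b₁ ≡ 0 → aB ≡ 0) → (b₁ ≡ 0 → bB ≡ 0) →
                       r * firstTreeCount h a b₁ ([ B ≡ᵗ h ] + r ∸ 1) aB bA
                         + (bA * firstTreeCount h a b₁ ([ B ≡ᵗ h ] + r) aB (bA ∸ 1) + bB * firstTreeCount h a b₁ ([ B ≡ᵗ h ] + r) aB bA)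
                       ≡ firstTreeCount h a (suc b₁) ([ B ≡ᵗ h ] + r) aB bA
firstTreeCount-stepB A a zero aB r bA bB b≡ _ bB≡0 rewrite bB≡0 refl = identity r bA ((a ∸ 1) !)
  where identity : ∀ r bA F → r * F + (bA * F + 0 * F) ≡ (r + bA) * F * 1
        identity = solve-∀
firstTreeCount-stepB B a zero aB r bA bB b≡ aB≡0 bB≡0 rewrite aB≡0 refl | bB≡0 refl
  with sym (trans (suc-injective b≡) (+-identityʳ (r + bA)))
... | r+bA≡0 rewrite m+n≡0⇒m≡0 r r+bA≡0 | m+n≡0⇒n≡0 r r+bA≡0 = identity ((a ∸ 1) !)
  where identity : ∀ F → 0 * F + (0 * F + 0 * F) ≡ 0 * F * 1
        identity = solve-∀
firstTreeCount-stepB A a (suc b₂) aB r bA bB b≡ _ _ = +-cancelʳ-≡ XFG _ _ (begin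
  r * f (r ∸ 1) + (bA * g (bA ∸ 1) + bB * XFG) + XFG
    ≡⟨ regroup r bA bB F G (f (r ∸ 1)) (g (bA ∸ 1)) ⟩
  (r * f (r ∸ 1) + r * (F * G)) + (bA * g (bA ∸ 1) + bA * (F * G)) + bB * XFG
    ≡⟨ cong₂ (λ x y → x + y + bB * XFG) (*-affine-pred f (F * G) (f-suc bA F G) r) (*-affine-pred g (F * G) (g-suc r F G) bA) ⟩
  r * XFG + bA * XFG + bB * XFG
    ≡⟨ distrib r bA bB XFG ⟩
  (r + bA + bB) * XFG
    ≡⟨ cong (_* XFG) (sym b≡) ⟩
  suc (suc b₂) * XFG
    ≡⟨ finish (r + bA) b₂ F G ⟩
  (r + bA) * F * (suc b₂ * G) + XFG
    ∎)
  where
    open ≡-Reasoning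
    F = (a ∸ 1) !
    G = b₂ !
    XFG = (r + bA) * F * G
    f g : ℕ → ℕ
    f y = (y + bA) * F * G
    g y = (r + y) * F * G
    f-suc : ∀ bA F G y → (suc y + bA) * F * G ≡ F * G + (y + bA) * F * G
    f-suc = solve-∀
    g-suc : ∀ r F G y → (r + suc y) * F * G ≡ F * G + (r + y) * F * G
    g-suc = solve-∀
    regroup : ∀ r bA bB F G p q → r * p + (bA * q + bB * ((r + bA) * F * G)) + (r + bA) * F * G
                                  ≡ (r * p + r * (F * G)) + (bA * q + bA * (F * G)) + bB * ((r + bA) * F * G)
    regroup = solve-∀
    distrib : ∀ x y z w → x * w + y * w + z * w ≡ (x + y + z) * w
    distrib = solve-∀
    finish : ∀ X b₂ F G → suc (suc b₂) * (X * F * G) ≡ X * F * (suc b₂ * G) + X * F * G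
    finish = solve-∀
firstTreeCount-stepB B a (suc b₂) aB r bA bB b≡ _ _ =
  trans (identity r bA bB aB ((a ∸ 1) !) (b₂ !)) (cong (λ x → aB * (a ∸ 1) ! * (x * b₂ !)) (sym (suc-injective b≡)))
  where identity : ∀ r bA bB aB F G → r * (aB * F * G) + (bA * (aB * F * G) + bB * (aB * F * G)) ≡ aB * F * ((r + bA + bB) * G)
        identity = solve-∀

-- As forestCount-step, for the forests whose first tree contains vertex 1, of
-- type A; the first root (of type h) is never the slot of the removed leaf.
firstTreeCount-step : ∀ t h a b rA rB aA aB bA bB →
                      a ≡ ([ A ≡ᵗ h ] + rA) + (aA + aB) → b ≡ ([ B ≡ᵗ h ] + rB) + (bA + bB) →
                      (t ≡ A → 2 ≤ a) → [ B ≡ᵗ t ] ≤ b → (b ≡ [ B ≡ᵗ t ] → aB ≡ 0 × bB ≡ 0) →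
                      let a′ = a ∸ [ A ≡ᵗ t ] ; b′ = b ∸ [ B ≡ᵗ t ] ; bO = [ B ≡ᵗ h ] + rB in
                      byType t rA rB * firstTreeCount h a′ b′ (bO ∸ [ B ≡ᵗ t ]) aB bA
                        + (byType t aA bA * firstTreeCount h a′ b′ bO aB (bA ∸ [ B ≡ᵗ t ])
                           + byType t aB bB * firstTreeCount h a′ b′ bO (aB ∸ [ A ≡ᵗ t ]) bA)
                      ≡ firstTreeCount h a b bO aB bA
firstTreeCount-step A h zero b rA rB aA aB bA bB a≡ b≡ 2≤a _ _ with 2≤a refl
... | ()
firstTreeCount-step A h (suc zero) b rA rB aA aB bA bB a≡ b≡ 2≤a _ _ with 2≤a refl
... | s≤s ()
firstTreeCount-step A h (suc (suc a₂)) b rA rB aA aB bA bB a≡ b≡ _ _ only-B =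
  firstTreeCount-stepA h a₂ b rA aA aB ([ B ≡ᵗ h ] + rB) bA (trans a≡ (sym (+-assoc ([ A ≡ᵗ h ] + rA) aA aB)))
    (λ b≡0 → proj₁ (only-B b≡0)) (no-B-vertex h b≡)
  where
    no-B-vertex : ∀ h {b x y} → b ≡ [ B ≡ᵗ h ] + x + y → b ≡ 0 → h ≡ A
    no-B-vertex A _  _   = refl
    no-B-vertex B b≡ b≡0 = ⊥-elim (0≢1+n (trans (sym b≡0) b≡))
firstTreeCount-step B h a (suc b₁) rA rB aA aB bA bB a≡ b≡ _ _ only-B =
  firstTreeCount-stepB h a b₁ aB rB bA bB (trans b≡ (sym (+-assoc ([ B ≡ᵗ h ] + rB) bA bB)))
    (λ b₁≡0 → proj₁ (only-B (cong suc b₁≡0))) (λ b₁≡0 → proj₂ (only-B (cong suc b₁≡0)))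

vertices : ∀ {n} → Ty → (Fin n → Ty × List Ty) → ℕ
vertices {n} c w = ∑[ i < n ] [ c ≡ᵗ typeOf w i ]

slotsUnder : ∀ {n} → Ty → Ty → (Fin n → Ty × List Ty) → ℕ
slotsUnder {n} p c w = ∑[ i < n ] countTy c (childTypesUnder p w i)

record Balanced {n} (w0 : List Ty) (w : Fin n → Ty × List Ty) : Set where
  field
    balanced : ∀ c → vertices c w ≡ countTy c w0 + (slotsUnder A c w + slotsUnder B c w)
open Balanced public

Consistent⇒Balanced : ∀ {n} {w0} {w : Fin n → Ty × List Ty} → Consistent w0 w → Balanced w0 w
Consistent⇒Balanced {w0 = w0} {w} cons = record { balanced = λ { A → one A (Consistent.consA cons) ; B → one B (Consistent.consB cons) } }
  where
    one : ∀ c → nVert c w ≡ nSlots c w0 w → vertices c w ≡ countTy c w0 + (slotsUnder A c w + slotsUnder B c w)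
    one c cons-c = trans (sym (nVert≡∑ w c)) (trans cons-c (cong (countTy c w0 +_)
      (trans (childSlots≡∑ w c) (trans (sum-cong-≗ (childTypes-split c w))
        (∑-distrib-+ (λ i → countTy c (childTypesUnder A w i)) (λ i → countTy c (childTypesUnder B w i)))))))

Counter : Set
Counter = (a b aᴼ bᴼ aᴮ bᴬ : ℕ) → ℕ

cong-Counter : ∀ (Φ : Counter) {x₁ x₂ x₃ x₄ x₅ x₆ y₁ y₂ y₃ y₄ y₅ y₆} →
               x₁ ≡ y₁ → x₂ ≡ y₂ → x₃ ≡ y₃ → x₄ ≡ y₄ → x₅ ≡ y₅ → x₆ ≡ y₆ → Φ x₁ x₂ x₃ x₄ x₅ x₆ ≡ Φ y₁ y₂ y₃ y₄ y₅ y₆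
cong-Counter Φ refl refl refl refl refl refl = refl

countWith : ∀ {n} → Counter → List Ty → (Fin n → Ty × List Ty) → ℕ
countWith Φ w0 w = Φ (vertices A w) (vertices B w) (countTy A w0) (countTy B w0) (slotsUnder B A w) (slotsUnder A B w)

countWith-stats : ∀ {n} (Φ : Counter) w0 (w : Fin n → Ty × List Ty) →
                  countWith Φ w0 w ≡ Φ (a-of w) (b-of w) (aᴼ w0) (bᴼ w0) (aᴮ w) (bᴬ w)
countWith-stats Φ w0 w =
  cong-Counter Φ (sym (nVert≡∑ w A)) (sym (nVert≡∑ w B)) refl refl (sym (nSlotsUnder≡∑ w B A)) (sym (nSlotsUnder≡∑ w A B))

firstTreeCounter : Ty → Counter
firstTreeCounter h a b _ bO aB bA = firstTreeCount h a b bO aB bA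

count : ∀ {n} → List Ty → (Fin n → Ty × List Ty) → ℕ
count = countWith forestCount

countFirst : ∀ {n} → Ty → List Ty → (Fin n → Ty × List Ty) → ℕ
countFirst h = countWith (firstTreeCounter h)

vertices-A+B : ∀ {n} (w : Fin n → Ty × List Ty) → vertices A w + vertices B w ≡ n
vertices-A+B w = trans (cong₂ _+_ (sym (nVert≡∑ w A)) (sym (nVert≡∑ w B))) (nVert-A+B w)

roots+slots≡n : ∀ {n} {w0} {w : Fin n → Ty × List Ty} → Balanced w0 w →
                length w0 + ∑[ i < n ] length (childTypes w i) ≡ n
roots+slots≡n {n} {w0} {w} bal = begin
  length w0 + ∑[ i < n ] length (childTypes w i)
    ≡⟨ cong₂ _+_ (sym (countTy-A+B w0)) (trans (sym (sum-cong-≗ (countTy-A+B ∘ childTypes w)))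
                                                (∑-distrib-+ (λ i → countTy A (childTypes w i)) (λ i → countTy B (childTypes w i)))) ⟩
  (countTy A w0 + countTy B w0) + (∑[ i < n ] countTy A (childTypes w i) + ∑[ i < n ] countTy B (childTypes w i))
    ≡⟨ interchange (countTy A w0) _ _ _ ⟩
  (countTy A w0 + ∑[ i < n ] countTy A (childTypes w i)) + (countTy B w0 + ∑[ i < n ] countTy B (childTypes w i))
    ≡⟨ cong₂ _+_ (slots A) (slots B) ⟩
  vertices A w + vertices B w
    ≡⟨ vertices-A+B w ⟩
  n ∎
  where
    open ≡-Reasoning
    slots : ∀ c → countTy c w0 + ∑[ i < n ] countTy c (childTypes w i) ≡ vertices c w
    slots c = sym (trans (balanced bal c) (cong (countTy c w0 +_)
      (trans (sym (∑-distrib-+ (λ i → countTy c (childTypesUnder A w i)) (λ i → countTy c (childTypesUnder B w i))))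
             (sym (sum-cong-≗ (childTypes-split c w))))))

∸-from-+ : ∀ {x} d {y} → x ≡ d + y → y ≡ x ∸ d
∸-from-+ d {y} refl = sym (m+n∸m≡n d y)

module Statistics {n : ℕ} (w0 : List Ty) (w : Fin (suc n) → Ty × List Ty) (v : Fin (suc n)) (leaf : childTypes w v ≡ []) where

  open LeafRemoval w0 w v leaf

  rootDrop : Slot → Ty → ℕ
  rootDrop (rootSlot _)  c = [ c ≡ᵗ t ]
  rootDrop (kidSlot _ _) c = 0

  kidDrop : Slot → Ty → Ty → ℕ
  kidDrop (rootSlot _)  p c = 0
  kidDrop (kidSlot u _) p c = if p ==ᵗ ty u then [ c ≡ᵗ t ] else 0

  vertices-removeLeaf : ∀ s c → vertices c w ≡ [ c ≡ᵗ t ] + vertices c (w′ s)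
  vertices-removeLeaf s c = sum-remove {i = v} (λ i → [ c ≡ᵗ ty i ])

  roots-removeLeaf : ∀ s c → countTy c w0 ≡ rootDrop s c + countTy c (rootTypes′ s)
  roots-removeLeaf (rootSlot p)  c = countTy-─ c p
  roots-removeLeaf (kidSlot _ _) c = refl

  private
    slots-v : ∀ p c → countTy c (childTypesUnder p w v) ≡ 0
    slots-v p c with p ==ᵗ ty v
    ... | true  = cong (countTy c) leaf
    ... | false = refl

    sum-slots-v : ∀ p c → slotsUnder p c w ≡ ∑[ y < n ] countTy c (childTypesUnder p w (ι y))
    sum-slots-v p c = trans (sum-remove {i = v} (λ i → countTy c (childTypesUnder p w i)))
                            (cong (_+ ∑[ y < n ] countTy c (childTypesUnder p w (ι y))) (slots-v p c))

  slotsUnder-removeLeaf : ∀ s p c → slotsUnder p c w ≡ kidDrop s p c + slotsUnder p c (w′ s)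
  slotsUnder-removeLeaf (rootSlot _)  p c = sum-slots-v p c
  slotsUnder-removeLeaf (kidSlot u q) p c with vertex u
  ... | the-leaf = ⊥-elim (leaf-no-slot q)
  ... | other u′ = trans (sum-slots-v p c) (sum-differ-at u′ at-u′ elsewhere)
    where
      at-u′ : countTy c (childTypesUnder p w (ι u′))
              ≡ (if p ==ᵗ ty (ι u′) then [ c ≡ᵗ t ] else 0) + countTy c (childTypesUnder p (w′ (kidSlot (ι u′) q)) u′)
      at-u′ rewrite childTypes′-here (ι u′) q with p ==ᵗ ty (ι u′)
      ... | true  = countTy-─ c q
      ... | false = refl
      elsewhere : ∀ y → u′ ≢ y → countTy c (childTypesUnder p w (ι y)) ≡ countTy c (childTypesUnder p (w′ (kidSlot (ι u′) q)) y)
      elsewhere y u′≢y with slotUnder (kidSlot (ι u′) q) (ι y)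
      ... | slot-here _ eq = ⊥-elim (u′≢y (punchIn-injective v u′ y (cong proj₁ (inj₂-injective eq))))
      ... | slot-elsewhere _ types≡ _ rewrite types≡ = refl

  no-slots-under : ∀ p c → vertices p w ≡ [ p ≡ᵗ t ] → slotsUnder p c w ≡ 0
  no-slots-under p c only-v = trans (sum-slots-v p c) (sum-zero _ none)
    where
      others≡0 : ∑[ y < n ] [ p ≡ᵗ ty (ι y) ] ≡ 0
      others≡0 = +-cancelˡ-≡ [ p ≡ᵗ t ] _ _ (trans (sym (sum-remove {i = v} (λ i → [ p ≡ᵗ ty i ]))) (trans only-v (sym (+-identityʳ _))))
      none : ∀ y → countTy c (childTypesUnder p w (ι y)) ≡ 0
      none y = helper (ty (ι y)) (n≤0⇒n≡0 (≤-trans (≤-sum (λ y → [ p ≡ᵗ ty (ι y) ]) y) (≤-reflexive others≡0)))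
        where
          helper : ∀ x → [ p ≡ᵗ x ] ≡ 0 → countTy c (if p ==ᵗ x then childTypes w (ι y) else []) ≡ 0
          helper x p≢x with p ==ᵗ x
          ... | false = refl

  balanced-removeLeaf : Balanced w0 w → ∀ s → Balanced (rootTypes′ s) (w′ s)
  balanced-removeLeaf bal s = record { balanced = λ c → +-cancelˡ-≡ [ c ≡ᵗ t ] _ _ (begin
    [ c ≡ᵗ t ] + vertices c (w′ s)
      ≡⟨ vertices-removeLeaf s c ⟨
    vertices c w
      ≡⟨ balanced bal c ⟩
    countTy c w0 + (slotsUnder A c w + slotsUnder B c w)
      ≡⟨ cong₂ _+_ (roots-removeLeaf s c) (cong₂ _+_ (slotsUnder-removeLeaf s A c) (slotsUnder-removeLeaf s B c)) ⟩
    (rootDrop s c + countTy c (rootTypes′ s)) + ((kidDrop s A c + slotsUnder A c (w′ s)) + (kidDrop s B c + slotsUnder B c (w′ s)))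
      ≡⟨ regroup (rootDrop s c) _ (kidDrop s A c) _ (kidDrop s B c) _ ⟩
    (rootDrop s c + (kidDrop s A c + kidDrop s B c)) + (countTy c (rootTypes′ s) + (slotsUnder A c (w′ s) + slotsUnder B c (w′ s)))
      ≡⟨ cong (_+ (countTy c (rootTypes′ s) + (slotsUnder A c (w′ s) + slotsUnder B c (w′ s)))) (drops s c) ⟩
    [ c ≡ᵗ t ] + (countTy c (rootTypes′ s) + (slotsUnder A c (w′ s) + slotsUnder B c (w′ s)))
      ∎) }
    where
      open ≡-Reasoning
      regroup : ∀ d₁ x d₂ y d₃ z → (d₁ + x) + ((d₂ + y) + (d₃ + z)) ≡ (d₁ + (d₂ + d₃)) + (x + (y + z))
      regroup = solve-∀
      drops : ∀ s c → rootDrop s c + (kidDrop s A c + kidDrop s B c) ≡ [ c ≡ᵗ t ]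
      drops (rootSlot p)  c = +-identityʳ _
      drops (kidSlot u q) c with ty u
      ... | A = +-identityʳ _
      ... | B = refl

  a b aO bO aB bA : ℕ
  a  = vertices A w
  b  = vertices B w
  aO = countTy A w0
  bO = countTy B w0
  aB = slotsUnder B A w
  bA = slotsUnder A B w

  -- Parametrised by the counting function, to serve both enumerations.
  module Slots (Φ : Counter) where

    rootCount : ℕ
    rootCount = Φ (a ∸ [ A ≡ᵗ t ]) (b ∸ [ B ≡ᵗ t ]) (aO ∸ [ A ≡ᵗ t ]) (bO ∸ [ B ≡ᵗ t ]) aB bA

    kidCount : Ty → ℕ
    kidCount A = Φ (a ∸ [ A ≡ᵗ t ]) (b ∸ [ B ≡ᵗ t ]) aO bO aB (bA ∸ [ B ≡ᵗ t ])
    kidCount B = Φ (a ∸ [ A ≡ᵗ t ]) (b ∸ [ B ≡ᵗ t ]) aO bO (aB ∸ [ A ≡ᵗ t ]) bA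

    slotCount : ∀ {R} → SlotIn R → ℕ
    slotCount (rootSlot _)  = rootCount
    slotCount (kidSlot u _) = kidCount (ty u)


    countWith-removeLeaf : ∀ s → countWith Φ (rootTypes′ s) (w′ s) ≡ slotCount s
    countWith-removeLeaf s@(rootSlot p) =
      cong-Counter Φ (∸-from-+ _ (vertices-removeLeaf s A)) (∸-from-+ _ (vertices-removeLeaf s B))
             (∸-from-+ _ (roots-removeLeaf s A)) (∸-from-+ _ (roots-removeLeaf s B))
             (∸-from-+ 0 (slotsUnder-removeLeaf s B A)) (∸-from-+ 0 (slotsUnder-removeLeaf s A B))
    countWith-removeLeaf s@(kidSlot u q) with ty u | slotsUnder-removeLeaf s B A | slotsUnder-removeLeaf s A B
    ... | A | aB≡ | bA≡ = cong-Counter Φ (∸-from-+ _ (vertices-removeLeaf s A)) (∸-from-+ _ (vertices-removeLeaf s B)) refl refl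
                                 (∸-from-+ 0 aB≡) (∸-from-+ _ bA≡)
    ... | B | aB≡ | bA≡ = cong-Counter Φ (∸-from-+ _ (vertices-removeLeaf s A)) (∸-from-+ _ (vertices-removeLeaf s B)) refl refl
                                 (∸-from-+ _ aB≡) (∸-from-+ 0 bA≡)

    Σ-slots↔ : ∀ R → Σ (SlotIn R) (Fin ∘ slotCount)
                     ↔ Fin (countTy t R * rootCount + ∑[ u < suc n ] (countTy t (childTypes w u) * kidCount (ty u)))
    Σ-slots↔ R = ↔-trans Σ-distribʳ-⊎ (↔-trans (positions×Fin↔ t R rootCount ⊎-↔ kids↔) (↔-sym (+↔⊎ {countTy t R * rootCount})))
      where
        kids↔ = ↔-trans Σ-assoc (↔-trans (Σ-cong (λ u → positions×Fin↔ t (childTypes w u) (kidCount (ty u))))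
                                           (Σ-Fin↔Fin-sum (λ u → countTy t (childTypes w u) * kidCount (ty u))))

    sum-kidCount : ∑[ u < suc n ] (countTy t (childTypes w u) * kidCount (ty u))
                   ≡ slotsUnder A t w * kidCount A + slotsUnder B t w * kidCount B
    sum-kidCount = begin
      ∑[ u < suc n ] (countTy t (childTypes w u) * kidCount (ty u))
        ≡⟨ sum-cong-≗ by-type ⟩
      ∑[ u < suc n ] (countTy t (childTypesUnder A w u) * kidCount A + countTy t (childTypesUnder B w u) * kidCount B)
        ≡⟨ ∑-distrib-+ (λ u → countTy t (childTypesUnder A w u) * kidCount A) (λ u → countTy t (childTypesUnder B w u) * kidCount B) ⟩
      ∑[ u < suc n ] (countTy t (childTypesUnder A w u) * kidCount A) + ∑[ u < suc n ] (countTy t (childTypesUnder B w u) * kidCount B)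
        ≡⟨ cong₂ _+_ (sym (*-distribʳ-sum (kidCount A) (λ u → countTy t (childTypesUnder A w u))))
                     (sym (*-distribʳ-sum (kidCount B) (λ u → countTy t (childTypesUnder B w u)))) ⟩
      slotsUnder A t w * kidCount A + slotsUnder B t w * kidCount B
        ∎
      where
        open ≡-Reasoning
        by-type : ∀ u → countTy t (childTypes w u) * kidCount (ty u)
                        ≡ countTy t (childTypesUnder A w u) * kidCount A + countTy t (childTypesUnder B w u) * kidCount B
        by-type u with ty u
        ... | A = sym (+-identityʳ _)
        ... | B = refl

  leaf-counted : ∀ c → [ c ≡ᵗ t ] ≤ vertices c w
  leaf-counted c = ≤-trans (m≤m+n [ c ≡ᵗ t ] _) (≤-reflexive (sym (sum-remove {i = v} (λ i → [ c ≡ᵗ ty i ]))))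

  slotsUnder≡byType : ∀ p → slotsUnder p t w ≡ byType t (slotsUnder p A w) (slotsUnder p B w)
  slotsUnder≡byType p with t
  ... | A = refl
  ... | B = refl

  open Slots forestCount public

  count-step : Balanced w0 w →
               countTy t w0 * rootCount + (slotsUnder A t w * kidCount A + slotsUnder B t w * kidCount B) ≡ count w0 w
  count-step bal rewrite countTy≡byType t w0 | slotsUnder≡byType A | slotsUnder≡byType B =
    forestCount-step t a b aO (slotsUnder A A w) aB bO bA (slotsUnder B B w) (balanced bal A) (balanced bal B)
      (leaf-counted A) (leaf-counted B)
      (λ only-v → no-slots-under A A only-v , no-slots-under A B only-v)
      (λ only-v → no-slots-under B A only-v , no-slots-under B B only-v)

-- Induction on the number of vertices

null? : (xs : List Ty) → Dec (xs ≡ [])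
null? []      = yes refl
null? (_ ∷ _) = no (λ ())

length≡0 : ∀ {X : Set} {xs : List X} → length xs ≡ 0 → xs ≡ []
length≡0 {xs = []} _ = refl

1≤length : ∀ (xs : List Ty) → xs ≢ [] → 1 ≤ length xs
1≤length []      xs≢[] = ⊥-elim (xs≢[] refl)
1≤length (_ ∷ _) _     = s≤s z≤n

roots≡[]-if-no-leaf : ∀ {n} {w0} {w : Fin n → Ty × List Ty} → Balanced w0 w → (∀ v → childTypes w v ≢ []) → w0 ≡ []
roots≡[]-if-no-leaf {n} {w0} {w} bal no-leaf = length≡0 (n≤0⇒n≡0 (+-cancelʳ-≤ n (length w0) 0 (begin
  length w0 + n                                    ≡⟨ cong (length w0 +_) (sum-const-1 n) ⟨
  length w0 + ∑[ i < n ] 1                         ≤⟨ +-monoʳ-≤ (length w0) (sum-mono-≤ (λ i → 1≤length _ (no-leaf i))) ⟩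
  length w0 + ∑[ i < n ] length (childTypes w i)   ≡⟨ roots+slots≡n bal ⟩
  n                                                ∎)))
  where open ≤-Reasoning

Reachable-[] : ∀ {n} (ks : Vec.Vec (List (Fin n)) n) {x} → ¬ Reachable ks [] x
Reachable-[] ks (root ())
Reachable-[] ks (step r _) = Reachable-[] ks r

no-forest-without-roots : ∀ {n} (w : Fin (suc n) → Ty × List Ty) → ¬ Forests [] w
no-forest-without-roots w (F , tF) =
  Reachable-[] (kids F) (subst (λ r → Reachable (kids F) r zero) (map≡[]⇒≡[] (typeOf w) (roots F) (root-types typed)) (reachable typed zero))
  where typed = T⇒IsTypedForest tF

forestCount-no-roots : ∀ a b aB bA → 1 ≤ a + b → forestCount a b 0 0 aB bA ≡ 0
forestCount-no-roots (suc a) zero    aB bA _ = refl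
forestCount-no-roots zero    (suc b) aB bA _ = refl
forestCount-no-roots (suc a) (suc b) aB bA _ rewrite *-zeroʳ aB = refl

Forests-no-roots↔ : ∀ {n} (w : Fin n → Ty × List Ty) → Forests [] w ↔ Fin (count [] w)
Forests-no-roots↔ {zero} w = mk↔ₛ′ (λ _ → zero) (λ _ → mkPF [] Vec.[] , _) (λ { zero → refl }) (λ { (mkPF [] Vec.[] , _) → refl })
Forests-no-roots↔ {suc n} w =
  ↔-trans (mk↔ₛ′ (λ F → ⊥-elim (no-forest-without-roots w F)) (λ ()) (λ ()) (λ F → ⊥-elim (no-forest-without-roots w F)))
          (Fin-cong (sym (forestCount-no-roots (vertices A w) (vertices B w) (slotsUnder B A w) (slotsUnder A B w)
                                               (≤-trans (s≤s z≤n) (≤-reflexive (sym (vertices-A+B w)))))))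

Forests↔count : ∀ n (w0 : List Ty) (w : Fin n → Ty × List Ty) → Balanced w0 w → Forests w0 w ↔ Fin (count w0 w)
Forests↔count n w0 w bal with any? (λ v → null? (childTypes w v))
... | no no-leaf rewrite roots≡[]-if-no-leaf bal (λ v leaf → no-leaf (v , leaf)) = Forests-no-roots↔ w
Forests↔count (suc m) w0 w bal | yes (v , leaf) =
  ↔-trans Forests↔ (↔-trans (Σ-cong (λ s → ↔-trans (Forests↔count m (rootTypes′ s) (w′ s) (balanced-removeLeaf bal s))
                                                  (Fin-cong (countWith-removeLeaf s))))
                   (↔-trans (Σ-slots↔ w0) (Fin-cong (trans (cong (countTy t w0 * rootCount +_) sum-kidCount) (count-step bal)))))
  where
    open LeafRemoval w0 w v leaf
    open Statistics w0 w v leaf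

module FirstStatistics {m : ℕ} (h : Ty) (w0t : List Ty) (w : Fin (suc (suc m)) → Ty × List Ty)
                       (j : Fin (suc m)) (leaf : childTypes w (suc j) ≡ []) where

  open LeafRemoval (h ∷ w0t) w (suc j) leaf
  open Statistics (h ∷ w0t) w (suc j) leaf using (a; b; aB; bA; leaf-counted; slotsUnder≡byType; no-slots-under)
  open Statistics.Slots (h ∷ w0t) w (suc j) leaf (firstTreeCounter h) public

  countFirst-step : Balanced (h ∷ w0t) w → ty zero ≡ A →
                    countTy t w0t * rootCount + (slotsUnder A t w * kidCount A + slotsUnder B t w * kidCount B)
                    ≡ countFirst h (h ∷ w0t) w
  countFirst-step bal ty0≡A rewrite countTy≡byType t w0t | slotsUnder≡byType A | slotsUnder≡byType B =
    firstTreeCount-step t h a b (countTy A w0t) (countTy B w0t) (slotsUnder A A w) aB bA (slotsUnder B B w)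
      (balanced bal A) (balanced bal B) two-A (leaf-counted B)
      (λ only-v → no-slots-under B A only-v , no-slots-under B B only-v)
    where
      two-A : t ≡ A → 2 ≤ a
      two-A t≡A = ≤-trans (≤-reflexive (cong₂ (λ x y → [ A ≡ᵗ x ] + [ A ≡ᵗ y ]) (sym t≡A) (sym ty0≡A)))
                          (two≤-sum (λ i → [ A ≡ᵗ ty i ]) {suc j} {zero} (λ ()))

roots≤1-if-no-other-leaf : ∀ {n} {h} {w0t} {w : Fin (suc n) → Ty × List Ty} → Balanced (h ∷ w0t) w →
                           (∀ j → childTypes w (suc j) ≢ []) → w0t ≡ []
roots≤1-if-no-other-leaf {n} {h} {w0t} {w} bal no-leaf = length≡0 (n≤0⇒n≡0 (+-cancelʳ-≤ n (length w0t) 0 (≤-pred (begin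
  suc (length w0t + n)                                        ≡⟨ cong (λ k → suc (length w0t + k)) (sum-const-1 n) ⟨
  suc (length w0t + sum (λ (i : Fin n) → 1))                   ≤⟨ s≤s (+-monoʳ-≤ (length w0t) (≤-trans (sum-mono-≤ (λ j → 1≤length _ (no-leaf j)))
                                                                                                        (m≤n+m _ (length (childTypes w zero))))) ⟩
  suc (length w0t + sum (λ i → length (childTypes w i)))       ≡⟨ roots+slots≡n bal ⟩
  suc n                                                        ∎))))
  where open ≤-Reasoning


forestCount≡firstTreeCount : ∀ h a b aB bA → 1 ≤ a → (b ≡ 0 → h ≡ A) →
                             forestCount a b (countTy A (h ∷ [])) (countTy B (h ∷ [])) aB bA
                             ≡ firstTreeCount h a b (countTy B (h ∷ [])) aB bA
forestCount≡firstTreeCount A (suc a₁) zero     aB bA _ _ = +-identityʳ (a₁  !)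
forestCount≡firstTreeCount A (suc a₁) (suc b₁) aB bA _ _ = identity aB bA (a₁  !) (b₁  !)
  where identity : ∀ aB bA F G → (1 * 0 + 1 * bA + aB * 0) * F * G ≡ (0 + bA) * F * G
        identity = solve-∀
forestCount≡firstTreeCount B (suc a₁) zero     aB bA _ h≡A with h≡A refl
... | ()
forestCount≡firstTreeCount B (suc a₁) (suc b₁) aB bA _ _ = identity aB bA (a₁  !) (b₁  !)
  where identity : ∀ aB bA F G → (0 * 1 + 0 * bA + aB * 1) * F * G ≡ aB * F * G
        identity = solve-∀

ForestsFirst-one-root↔ : ∀ {n} h (w : Fin (suc n) → Ty × List Ty) → ForestsFirst (h ∷ []) w ↔ Forests (h ∷ []) w
ForestsFirst-one-root↔ h w = mk↔ₛ′ (λ (F , t) → F , proj₁ (T-∧-∧⁻ {isForest F} t))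
                                  (λ (F , t) → F , T-∧-∧⁺ {isForest F} t (in-first F t))
                                  (λ (F , t) → cong (F ,_) (T-irrelevant _ _))
                                  (λ (F , t) → cong (F ,_) (T-irrelevant _ _))
  where
    take1-single : ∀ {X : Set} (r : List X) → length r ≡ 1 → take 1 r ≡ r
    take1-single (_ ∷ []) _ = refl
    in-first : ∀ F → T (isForest F ∧ hasTypeArray (h ∷ []) w F) → T (inFirstTree zero F)
    in-first F t = T-inFirstTree⁺ F (subst (λ r → Reachable (kids F) r zero) (sym (take1-single (roots F) one-root)) (reachable typed zero))
      where
        typed = T⇒IsTypedForest t
        one-root = trans (sym (length-map (typeOf w) (roots F))) (cong length (root-types typed))

ForestsFirst-one-root↔countFirst : ∀ {n} h {w0t} (w : Fin (suc n) → Ty × List Ty) → w0t ≡ [] → Balanced (h ∷ w0t) w →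
                                  typeOf w zero ≡ A → ForestsFirst (h ∷ w0t) w ↔ Fin (countFirst h (h ∷ w0t) w)
ForestsFirst-one-root↔countFirst h w refl bal ty0≡A =
  ↔-trans (ForestsFirst-one-root↔ h w)
    (↔-trans (Forests↔count _ _ w bal) (Fin-cong (forestCount≡firstTreeCount h (vertices A w) (vertices B w) _ _ 1≤a (no-B-root h (balanced bal B)))))
  where
    1≤a : 1 ≤ vertices A w
    1≤a = ≤-trans (≤-reflexive (cong [ A ≡ᵗ_] (sym ty0≡A))) (≤-sum (λ i → [ A ≡ᵗ typeOf w i ]) zero)
    no-B-root : ∀ h {x} → vertices B w ≡ countTy B (h ∷ []) + x → vertices B w ≡ 0 → h ≡ A
    no-B-root A _  _   = refl
    no-B-root B b≡ b≡0 = ⊥-elim (0≢1+n (trans (sym b≡0) b≡))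

ForestsFirst↔countFirst : ∀ m h w0t (w : Fin (suc m) → Ty × List Ty) → Balanced (h ∷ w0t) w → typeOf w zero ≡ A →
                          ForestsFirst (h ∷ w0t) w ↔ Fin (countFirst h (h ∷ w0t) w)
ForestsFirst↔countFirst zero h w0t w bal ty0≡A =
  ForestsFirst-one-root↔countFirst h w (roots≤1-if-no-other-leaf bal (λ ())) bal ty0≡A
ForestsFirst↔countFirst (suc m) h w0t w bal ty0≡A with any? (λ j → null? (childTypes w (suc j)))
... | no no-leaf =
  ForestsFirst-one-root↔countFirst h w (roots≤1-if-no-other-leaf bal (λ j leaf → no-leaf (j , leaf))) bal ty0≡A
... | yes (j , leaf) =
  ↔-trans ForestsFirst↔ (↔-trans (Σ-cong with-leaf-at)
    (↔-trans (Σ-slots↔ w0t) (Fin-cong (trans (cong (countTy t w0t * rootCount +_) sum-kidCount) (countFirst-step bal ty0≡A)))))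
  where
    open LeafRemoval (h ∷ w0t) w (suc j) leaf
    open Statistics (h ∷ w0t) w (suc j) leaf using (balanced-removeLeaf)
    open LeafRemovalFirst h w0t w j leaf
    open FirstStatistics h w0t w j leaf
    with-leaf-at : ∀ s₁ → ForestsFirst (rootTypes′ (embed s₁)) (w′ (embed s₁)) ↔ Fin (slotCount s₁)
    with-leaf-at s₁@(inj₁ p) = ↔-trans (ForestsFirst↔countFirst m h (w0t ─ p) _ (balanced-removeLeaf bal (embed s₁)) ty0≡A)
                                       (Fin-cong (countWith-removeLeaf (embed s₁)))
    with-leaf-at s₁@(inj₂ _) = ↔-trans (ForestsFirst↔countFirst m h w0t _ (balanced-removeLeaf bal (embed s₁)) ty0≡A)
                                       (Fin-cong (countWith-removeLeaf (embed s₁)))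

Forests↔forestCount : ∀ {n} w0 (w : Fin n → Ty × List Ty) → Consistent w0 w →
                      Forests w0 w ↔ Fin (forestCount (a-of w) (b-of w) (aᴼ w0) (bᴼ w0) (aᴮ w) (bᴬ w))
Forests↔forestCount w0 w cons = ↔-trans (Forests↔count _ w0 w (Consistent⇒Balanced cons))
  (Fin-cong (countWith-stats forestCount w0 w))

ForestsFirst↔firstTreeCount : ∀ {m} h w0t (w : Fin (suc m) → Ty × List Ty) → Consistent (h ∷ w0t) w → typeOf w zero ≡ A →
                              ForestsFirst (h ∷ w0t) w ↔ Fin (firstTreeCount h (a-of w) (b-of w) (bᴼ (h ∷ w0t)) (aᴮ w) (bᴬ w))
ForestsFirst↔firstTreeCount h w0t w cons ty0≡A = ↔-trans (ForestsFirst↔countFirst _ h w0t w (Consistent⇒Balanced cons) ty0≡A)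
  (Fin-cong (countWith-stats (firstTreeCounter h) (h ∷ w0t) w))

Fin↔-via : ∀ {X : Set} {m k} → X ↔ Fin m → m ≡ k → Fin k ↔ X
Fin↔-via X↔m m≡k = ↔-trans (Fin-cong (sym m≡k)) (↔-sym X↔m)

module _ {aO bO aB bA : ℕ} where

  forestCount-++ : ∀ {a b} → 0 < a → 0 < b → forestCount a b aO bO aB bA ≡ (aO * bO + aO * bA + aB * bO) * (a ∸ 1) ! * (b ∸ 1) !
  forestCount-++ {suc a} {suc b} _ _ = refl

  forestCount-+0 : ∀ {a b} → 0 < a → b ≡ 0 → forestCount a b aO bO aB bA ≡ aO * (a ∸ 1) !
  forestCount-+0 {suc a} _ refl = refl

  forestCount-0+ : ∀ {a b} → a ≡ 0 → 0 < b → forestCount a b aO bO aB bA ≡ bO * (b ∸ 1) !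
  forestCount-0+ {b = suc b} refl _ = refl

  forestCount-00 : ∀ {a b} → a ≡ 0 → b ≡ 0 → forestCount a b aO bO aB bA ≡ 1
  forestCount-00 refl refl = refl

module _ {bO aB bA : ℕ} where

  firstTreeCount-A+ : ∀ {a b} → 0 < b → firstTreeCount A a b bO aB bA ≡ (bO + bA) * (a ∸ 1) ! * (b ∸ 1) !
  firstTreeCount-A+ {b = suc b} _ = refl

  firstTreeCount-B+ : ∀ {a b} → 0 < b → firstTreeCount B a b bO aB bA ≡ aB * (a ∸ 1) ! * (b ∸ 1) !
  firstTreeCount-B+ {b = suc b} _ = refl

  firstTreeCount-0 : ∀ h {a b} → b ≡ 0 → firstTreeCount h a b bO aB bA ≡ (a ∸ 1) !
  firstTreeCount-0 h refl = refl

proposition21 :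
    ((n : ℕ) (w0 : List Ty) (w : Fin n → Ty × List Ty) → Consistent w0 w →
        (0 < a-of w → 0 < b-of w →
           Fin ((aᴼ w0 * bᴼ w0 + aᴼ w0 * bᴬ w + aᴮ w * bᴼ w0) * (a-of w ∸ 1) ! * (b-of w ∸ 1) !)
             ↔ Forests w0 w)
      × (0 < a-of w → b-of w ≡ 0 → Fin (aᴼ w0 * (a-of w ∸ 1) !) ↔ Forests w0 w)
      × (a-of w ≡ 0 → 0 < b-of w → Fin (bᴼ w0 * (b-of w ∸ 1) !) ↔ Forests w0 w)
      × (a-of w ≡ 0 → b-of w ≡ 0 → Fin 1 ↔ Forests w0 w))
    ×
    ((m : ℕ) (w0 : List Ty) (w : Fin (suc m) → Ty × List Ty) → Consistent w0 w →
        w0 ≢ [] → 1 < a-of w → proj₁ (w zero) ≡ A →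
        (0 < b-of w → head w0 ≡ just A →
           Fin ((bᴼ w0 + bᴬ w) * (a-of w ∸ 1) ! * (b-of w ∸ 1) !) ↔ ForestsFirst w0 w)
      × (0 < b-of w → head w0 ≡ just B →
           Fin (aᴮ w * (a-of w ∸ 1) ! * (b-of w ∸ 1) !) ↔ ForestsFirst w0 w)
      × (b-of w ≡ 0 → Fin ((a-of w ∸ 1) !) ↔ ForestsFirst w0 w))
proposition21 =
    (λ n w0 w cons → let forests↔ = Forests↔forestCount w0 w cons in
        (λ a>0 b>0 → Fin↔-via forests↔ (forestCount-++ a>0 b>0))
      , (λ a>0 b≡0 → Fin↔-via forests↔ (forestCount-+0 a>0 b≡0))
      , (λ a≡0 b>0 → Fin↔-via forests↔ (forestCount-0+ a≡0 b>0))
      , (λ a≡0 b≡0 → Fin↔-via forests↔ (forestCount-00 a≡0 b≡0)))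
  , λ where
      m []        w cons w0≢[] _ _     → ⊥-elim (w0≢[] refl)
      m (h ∷ w0t) w cons _     _ ty0≡A → let forests↔ = ForestsFirst↔firstTreeCount h w0t w cons ty0≡A in
          (λ { b>0 refl → Fin↔-via forests↔ (firstTreeCount-A+ b>0) })
        , (λ { b>0 refl → Fin↔-via forests↔ (firstTreeCount-B+ b>0) })
        , (λ b≡0 → Fin↔-via forests↔ (firstTreeCount-0 h b≡0))
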